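{- Let $Z_n=(\mathrm{UD})^n$ denote the zig-zag Dyck path UDUD$\cdots$UD of order $n$. For each permutation $\sigma$ of order $n$, $\operatorname{art}(\operatorname{DTR}(Z_n,\sigma))=\mathrm{mad}(\sigma)$.
   Context: For a permutation $\sigma$, let $\mathrm{DES}(\sigma)=\{i<n:\sigma_i>\sigma_{i+1}\}$, $\mathrm{desdif}(\sigma)=\sum_{i\in\mathrm{DES}(\sigma)}(\sigma_i-\sigma_{i+1})$, $\mathrm{res}(\sigma)=\sum_{i\in\mathrm{DES}(\sigma)}\#\{k<i:\sigma_i>\sigma_k>\sigma_{i+1}\}$, and $\mathrm{mad}(\sigma)=\mathrm{desdif}(\sigma)+\mathrm{res}(\sigma)$ (Clarke–Steingrímsson–Zeng). For a Dyck tiling $T$, $\operatorname{art}(T)=(\mathrm{area}(T)+\mathrm{tiles}(T))/2$, where area is the number of boxes and tiles the number of tiles. For $\lambda=Z_n$ the chord poset is an antichain, so its linear extensions are all of $S_n$. Dyck tilings: for Dyck paths $\mu$ weakly above $\lambda$ (paths with steps $(+1,\pm1)$ from $(-n,0)$ to $(n,0)$ at height $\ge0$), a Dyck tile is a ribbon tile (connected skew shape without a $2\times2$ square) whose leftmost and rightmost boxes are at equal height with no box below them; a Dyck tiling tiles the skew shape between $\lambda$ and $\mu$. Labeled trees $(\lambda,\sigma)$ (chords of $\lambda$ = segments between matching up/down steps, naturally labeled $1..n$ respecting nesting; $\sigma$ = standardization of the left endpoints $\ell_1,\dots,\ell_n$) correspond to sequences $p_1,\dots,p_n$, $0\le p_i\le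 2(i-1)$, $p_i=\#\{j<i:\ell_j<\ell_i\}+\#\{j<i:r_j<\ell_i\}$ ($r_j$ right endpoints). The spread of a path at column $s$ shifts points with $x\le s$ by $(-1,0)$, points with $x\ge s$ by $(+1,0)$, and points at $x=s$ also by $(0,+1)$; a tiling is spread by spreading its boundaries and tiles (tiles coordinatized by the path of lower corners of their boxes). A column $s$ of a tiling of $\lambda/\mu$ is eligible if $\mu$ has an up step ending at column $s$ and $\mu$'s point at $s$ is not the top corner of a one-box tile; the special column is the rightmost eligible one. ribbon-grow$(T,s)$ spreads $T$ at $s$ and, if the spread's special column $Q$ lies right of $s$, adds a ribbon of one-box tiles on top in columns strictly between $s$ and $Q$. $\operatorname{DTR}(p_1,\dots,p_n)$ is obtained from the empty tiling by applying ribbon-grow at column $p_k-(k-1)$ for $k=1,\dots,n$, and $\operatorname{DTR}(\lambda,\sigma)$ is this map applied to the sequence of the labeled tree $(\lambda,\sigma)$; its lower path is $\lambda$. -}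

module Defs where

open import Data.Nat as N using (ℕ; zero; suc; _∸_)
open import Data.Nat.DivMod using (_/_)
open import Data.Integer as Z using (ℤ; +_)
open import Data.Integer.Properties as ℤP using ()
open import Data.Bool using (Bool; true; false; if_then_else_; _∧_; not)
open import Data.List using (List; []; _∷_; _++_; map; length; concatMap; foldl; foldr; replicate; concat)
open import Data.Nat.ListAction using (sum)
open import Data.Bool.ListAction using (any)
open import Data.Maybe using (Maybe; just; nothing)
open import Data.Product using (_×_; _,_; proj₁; proj₂)
open import Data.Product.Properties using (≡-dec)
open import Data.Fin using (Fin; toℕ)
open import Data.Fin.Permutation using (Permutation′; _⟨$⟩ʳ_)
open import Data.List using (upTo; allFin)
open import Relation.Nullary using (does)

_<ℕ_ : ℕ → ℕ → Bool
a <ℕ b = does (a N.<? b)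

_<ℤ_ : ℤ → ℤ → Bool
a <ℤ b = does (a Z.<? b)

_=ℤ_ : ℤ → ℤ → Bool
a =ℤ b = does (a Z.≟ b)

filter : {A : Set} → (A → Bool) → List A → List A
filter p [] = []
filter p (x ∷ xs) = if p x then x ∷ filter p xs else filter p xs

count : {A : Set} → (A → Bool) → List A → ℕ
count p xs = length (filter p xs)

-- Permutation statistics (Clarke–Steingrímsson–Zeng).
-- A permutation is given by its word σ_1 … σ_n (values 0..n-1, which does
-- not affect the statistics below).

desdif : List ℕ → ℕ
desdif (a ∷ b ∷ w) = (if b <ℕ a then a ∸ b else 0) + desdif (b ∷ w)
  where open N using (_+_)
desdif _ = 0

resFrom : List ℕ → List ℕ → ℕ
resFrom pre (a ∷ b ∷ w) =
  (if b <ℕ a then count (λ c → (b <ℕ c) ∧ (c <ℕ a)) pre else 0)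
  + resFrom (pre ++ (a ∷ [])) (b ∷ w)
  where open N using (_+_)
resFrom pre _ = 0

res : List ℕ → ℕ
res w = resFrom [] w

mad : List ℕ → ℕ
mad w = desdif w N.+ res w

word : ∀ {n} → Permutation′ n → List ℕ
word {n} σ = map (λ i → toℕ (σ ⟨$⟩ʳ i)) (allFin n)

data Step : Set where
  U D : Step

Z : ℕ → List Step
Z n = concat (replicate n (U ∷ D ∷ []))

-- position of the down step matching an up step; arguments: current
-- relative depth, current position, remaining word
matchD : ℕ → ℕ → List Step → ℕ
matchD d pos [] = pos
matchD d pos (U ∷ w) = matchD (suc d) (suc pos) w
matchD zero pos (D ∷ w) = pos
matchD (suc d) pos (D ∷ w) = matchD d (suc pos) w

-- chords (left endpoint, right endpoint), steps numbered from 1,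
-- listed in increasing order of left endpoint
chordsFrom : ℕ → List Step → List (ℕ × ℕ)
chordsFrom pos [] = []
chordsFrom pos (U ∷ w) = (pos , matchD 0 (suc pos) w) ∷ chordsFrom (suc pos) w
chordsFrom pos (D ∷ w) = chordsFrom (suc pos) w

chords : List Step → List (ℕ × ℕ)
chords w = chordsFrom 1 w

nthD : {A : Set} → A → List A → ℕ → A
nthD d [] _ = d
nthD d (x ∷ xs) zero = x
nthD d (x ∷ xs) (suc k) = nthD d xs k

-- Labeled tree (λ, σ): the chord labeled i is the σ_i-th chord from the
-- left, so that σ is the standardization of ℓ_1 … ℓ_n.
-- (ℓ_i , r_i) for i = 1..n (list index i-1)
labeledChords : ∀ {n} → List Step → Permutation′ n → List (ℕ × ℕ)
labeledChords λp σ = map (λ v → nthD (0 , 0) (chords λp) v) (word σ)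

seqFrom : List (ℕ × ℕ) → List (ℕ × ℕ) → List ℕ
seqFrom pre [] = []
seqFrom pre ((l , r) ∷ cs) =
  (count (λ c → proj₁ c <ℕ l) pre N.+ count (λ c → proj₂ c <ℕ l) pre)
  ∷ seqFrom (pre ++ ((l , r) ∷ [])) cs

treeSeq : ∀ {n} → List Step → Permutation′ n → List ℕ
treeSeq λp σ = seqFrom [] (labeledChords λp σ)

-- A path is its list of lattice points (x , y), left to
-- right; a tile is the path of the lower corners of its boxes (a one-box
-- tile is a single point).  The box with lower corner (x,y) has top
-- corner (x,y+2).

Point : Set
Point = ℤ × ℤ

Path : Set
Path = List Point

record Tiling : Set where
  constructor tiling
  field
    lower : Path
    upper : Path
    tiles : List Path
open Tiling public

spreadPt : ℤ → Point → List Point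
spreadPt s (x , y) =
  if x <ℤ s then (x Z.- Z.1ℤ , y) ∷ []
  else if s <ℤ x then (x Z.+ Z.1ℤ , y) ∷ []
  else (s Z.- Z.1ℤ , y) ∷ (s , y Z.+ Z.1ℤ) ∷ (s Z.+ Z.1ℤ , y) ∷ []

spreadPath : ℤ → Path → Path
spreadPath s p = concatMap (spreadPt s) p

spread : Tiling → ℤ → Tiling
spread T s = tiling (spreadPath s (lower T)) (spreadPath s (upper T))
                    (map (spreadPath s) (tiles T))

upEnds : Path → List Point
upEnds ((x₀ , y₀) ∷ (x₁ , y₁) ∷ p) =
  (if y₁ =ℤ (y₀ Z.+ Z.1ℤ) then (x₁ , y₁) ∷ [] else []) ++ upEnds ((x₁ , y₁) ∷ p)
upEnds _ = []

isOneBoxAt : Point → Path → Bool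
isOneBoxAt q (p ∷ []) = does (≡-dec Z._≟_ Z._≟_ p q)
isOneBoxAt q _ = false

isTopOfOneBox : Tiling → Point → Bool
isTopOfOneBox T (x , y) = any (isOneBoxAt (x , y Z.- (+ 2))) (tiles T)

eligibleColumns : Tiling → List ℤ
eligibleColumns T =
  map proj₁ (filter (λ q → not (isTopOfOneBox T q)) (upEnds (upper T)))

maxMaybe : List ℤ → Maybe ℤ
maxMaybe = foldr step nothing
  where
  step : ℤ → Maybe ℤ → Maybe ℤ
  step x nothing = just x
  step x (just m) = just (x Z.⊔ m)

special : Tiling → Maybe ℤ
special T = maxMaybe (eligibleColumns T)

strictlyBetween : ℤ → ℤ → Point → Bool
strictlyBetween s Q (x , y) = (s <ℤ x) ∧ (x <ℤ Q)

addRibbon : ℤ → ℤ → Tiling → Tiling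
addRibbon s Q T =
  tiling (lower T)
         (map (λ q → if strictlyBetween s Q q then (proj₁ q , proj₂ q Z.+ (+ 2)) else q) (upper T))
         (tiles T ++ map (λ q → q ∷ [])
                         (filter (strictlyBetween s Q) (upper T)))

ribbonGrow : Tiling → ℤ → Tiling
ribbonGrow T s with special (spread T s)
... | nothing = spread T s
... | just Q = if s <ℤ Q then addRibbon s Q (spread T s) else spread T s

emptyTiling : Tiling
emptyTiling = tiling ((+ 0 , + 0) ∷ []) ((+ 0 , + 0) ∷ []) []

DTRseqFrom : ℕ → Tiling → List ℕ → Tiling
DTRseqFrom k T [] = T
DTRseqFrom k T (p ∷ ps) = DTRseqFrom (suc k) (ribbonGrow T ((+ p) Z.- (+ k))) ps

DTRseq : List ℕ → Tiling
DTRseq ps = DTRseqFrom 0 emptyTiling ps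

DTR : ∀ {n} → List Step → Permutation′ n → Tiling
DTR λp σ = DTRseq (treeSeq λp σ)

area : Tiling → ℕ
area T = sum (map length (tiles T))

numTiles : Tiling → ℕ
numTiles T = length (tiles T)

art : Tiling → ℕ
art T = (area T N.+ numTiles T) / 2

-- On Z_n every chord is its own hump, so the tree sequence is
-- p_k = 2·#{j < k : σ_j < σ_k} and the ribbon-grow steps can be followed
-- explicitly. After inserting σ_1 … σ_k the upper path occupies the
-- columns −k … k, the special column lies just right of the column of
-- σ_k, and the column at which a value z would be inserted holds one box
-- for every descent σ_i > σ_{i+1} with σ_{i+1} < z < σ_i. Inserting x
-- spreads its column, adding two boxes per such descent, and if σ_k > x
-- it lays a ribbon of 2·#{j < k : x < σ_j < σ_k} + 1 one-box tiles. So
-- art counts every descent once, every residue twice, and every later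
-- value lying between the two letters of a descent once. As σ is a
-- permutation, σ_i − σ_{i+1} − 1 counts exactly those residues and later
-- values, and the total is desdif + res = mad.

module Submission where

open import Defs
open import Data.Nat as N using (ℕ; zero; suc; _∸_; _+_; _<_; _≤_; z≤n; s≤s)
import Data.Nat.Properties as NP
open import Algebra.Properties.CommutativeSemigroup NP.+-commutativeSemigroup using () renaming (interchange to +-interchange)
open import Data.Nat.DivMod using (_/_; m*n/n≡m)
open import Data.Nat.ListAction using (sum)
open import Data.Nat.ListAction.Properties using (sum-++)
open import Data.Nat.Tactic.RingSolver using () renaming (solve-∀ to solveℕ)
open import Data.Integer as Z using (ℤ; +_; 1ℤ; 0ℤ) renaming (_+_ to _+ᶻ_; _-_ to _-ᶻ_)
import Data.Integer.Properties as ZP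
open import Data.Integer.Tactic.RingSolver using () renaming (solve-∀ to solveℤ)
open import Data.Bool using (Bool; true; false; if_then_else_; _∧_; not; _∨_)
open import Data.Bool.Properties using (∧-zeroʳ; ∨-zeroʳ)
open import Data.Bool.ListAction using (any)
open import Data.List using (List; []; _∷_; _++_; map; length; reverse; _∷ʳ_; allFin; tabulate; initLast; _∷ʳ′_)
import Data.List.Properties as LP
open import Data.List.Relation.Unary.All as All using (All; []; _∷_)
import Data.List.Relation.Unary.All.Properties as AllP
open import Data.List.Relation.Unary.Any using (here; there)
open import Data.List.Relation.Unary.AllPairs using ([]; _∷_)
open import Data.List.Relation.Unary.Unique.Propositional using (Unique)
import Data.List.Relation.Unary.Unique.Propositional.Properties as Unique
open import Data.List.Membership.Propositional using (_∈_; _∉_)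
open import Data.List.Relation.Binary.Permutation.Propositional using (↭-sym)
open import Data.List.Relation.Binary.Permutation.Propositional.Properties using (All-resp-↭; ↭-reverse)
open import Data.Product using (_×_; _,_; proj₁; proj₂; Σ-syntax)
open import Data.Product.Properties using (≡-dec)
open import Data.Maybe using (just)
open import Data.Empty using (⊥-elim)
open import Data.Fin using (Fin; toℕ)
import Data.Fin.Properties as FP
open import Data.Fin.Permutation using (Permutation′; _⟨$⟩ʳ_; _⟨$⟩ˡ_; inverseˡ)
open import Algebra.Properties.CommutativeMonoid.Sum NP.+-0-commutativeMonoid
  using (sum-permute) renaming (sum to ∑)
open import Relation.Binary using (tri<; tri≈; tri>)
open import Relation.Binary.PropositionalEquality
open import Relation.Nullary using (¬_; yes; no)
open import Relation.Nullary.Decidable using (dec-true; dec-false)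

𝟙 : Bool → ℕ
𝟙 b = if b then 1 else 0

<ℕ-true : ∀ {a b} → a < b → (a <ℕ b) ≡ true
<ℕ-true {a} {b} = dec-true (a N.<? b)

<ℕ-false : ∀ {a b} → ¬ a < b → (a <ℕ b) ≡ false
<ℕ-false {a} {b} = dec-false (a N.<? b)

<ℕ-true⁻¹ : ∀ {a b} → (a <ℕ b) ≡ true → a < b
<ℕ-true⁻¹ {a} {b} e with a N.<? b
... | yes a<b = a<b
... | no  a≮b with trans (sym e) (<ℕ-false a≮b)
...   | ()

<ℕ-false⁻¹ : ∀ {a b} → (a <ℕ b) ≡ false → ¬ a < b
<ℕ-false⁻¹ e a<b with trans (sym (<ℕ-true a<b)) e
... | ()

<ℕ-irrefl : ∀ a → (a <ℕ a) ≡ false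
<ℕ-irrefl a = <ℕ-false {a} {a} (NP.<-irrefl refl)

<ℕ-cong : ∀ {a b c d} → (a < b → c < d) → (c < d → a < b) → (a <ℕ b) ≡ (c <ℕ d)
<ℕ-cong {a} {b} f g with a <ℕ b in e
... | true  = sym (<ℕ-true (f (<ℕ-true⁻¹ e)))
... | false = sym (<ℕ-false (λ c<d → <ℕ-false⁻¹ e (g c<d)))

module _ {A : Set} where

  count-∷ : ∀ (p : A → Bool) x xs → count p (x ∷ xs) ≡ 𝟙 (p x) + count p xs
  count-∷ p x xs with p x
  ... | true  = refl
  ... | false = refl

  count-++ : ∀ (p : A → Bool) xs ys → count p (xs ++ ys) ≡ count p xs + count p ys
  count-++ p []       ys = refl
  count-++ p (x ∷ xs) ys
    rewrite count-∷ p x (xs ++ ys) | count-∷ p x xs | count-++ p xs ys =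
    sym (NP.+-assoc (𝟙 (p x)) _ _)

  count-reverse : ∀ (p : A → Bool) xs → count p (reverse xs) ≡ count p xs
  count-reverse p []       = refl
  count-reverse p (x ∷ xs)
    rewrite LP.unfold-reverse x xs | count-++ p (reverse xs) (x ∷ [])
          | count-∷ p x [] | count-∷ p x xs | count-reverse p xs
          | NP.+-identityʳ (𝟙 (p x)) = NP.+-comm (count p xs) (𝟙 (p x))

  count-cong : ∀ {p q : A → Bool} → (∀ x → p x ≡ q x) → ∀ xs → count p xs ≡ count q xs
  count-cong         p≗q []       = refl
  count-cong {p} {q} p≗q (x ∷ xs)
    rewrite count-∷ p x xs | count-∷ q x xs | p≗q x | count-cong p≗q xs = refl

  count-none : ∀ (p : A → Bool) xs → All (λ x → p x ≡ false) xs → count p xs ≡ 0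
  count-none p []       []       = refl
  count-none p (x ∷ xs) (e ∷ es) rewrite e = count-none p xs es

  count-≤-length : ∀ (p : A → Bool) xs → count p xs ≤ length xs
  count-≤-length p []       = z≤n
  count-≤-length p (x ∷ xs) with p x
  ... | true  = s≤s (count-≤-length p xs)
  ... | false = NP.m≤n⇒m≤1+n (count-≤-length p xs)

  count-mono : ∀ (p q : A → Bool) → (∀ x → p x ≡ true → q x ≡ true) →
               ∀ xs → count p xs ≤ count q xs
  count-mono p q p⇒q []       = z≤n
  count-mono p q p⇒q (x ∷ xs) with p x in e
  ... | true rewrite p⇒q x e = s≤s (count-mono p q p⇒q xs)
  ... | false with q x
  ...   | true  = NP.m≤n⇒m≤1+n (count-mono p q p⇒q xs)
  ...   | false = count-mono p q p⇒q xs

  filter-++ : ∀ (f : A → Bool) xs ys → filter f (xs ++ ys) ≡ filter f xs ++ filter f ys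
  filter-++ f []       ys = refl
  filter-++ f (x ∷ xs) ys with f x
  ... | true  = cong (x ∷_) (filter-++ f xs ys)
  ... | false = filter-++ f xs ys

  filter-none : ∀ (f : A → Bool) xs → All (λ p → f p ≡ false) xs → filter f xs ≡ []
  filter-none f []       []       = refl
  filter-none f (x ∷ xs) (e ∷ es) rewrite e = filter-none f xs es

  filter-all : ∀ (f : A → Bool) xs → All (λ p → f p ≡ true) xs → filter f xs ≡ xs
  filter-all f []       []       = refl
  filter-all f (x ∷ xs) (e ∷ es) rewrite e = cong (x ∷_) (filter-all f xs es)

  filter-All : ∀ {Q : A → Set} (f : A → Bool) xs → All Q xs → All Q (filter f xs)
  filter-All f []       []       = []
  filter-All f (x ∷ xs) (q ∷ qs) with f x
  ... | true  = q ∷ filter-All f xs qs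
  ... | false = filter-All f xs qs

count-map : ∀ {A B : Set} (p : B → Bool) (f : A → B) xs →
            count p (map f xs) ≡ count (λ x → p (f x)) xs
count-map p f []       = refl
count-map p f (x ∷ xs)
  rewrite count-∷ p (f x) (map f xs) | count-∷ (λ x → p (f x)) x xs | count-map p f xs = refl

any-map : ∀ {A B : Set} (f : B → Bool) (g : A → B) (h : A → Bool) → (∀ a → f (g a) ≡ h a) →
          ∀ xs → any f (map g xs) ≡ any h xs
any-map f g h fg≗h []       = refl
any-map f g h fg≗h (x ∷ xs) rewrite fg≗h x | any-map f g h fg≗h xs = refl

any-false : ∀ {A : Set} (f : A → Bool) → (∀ a → f a ≡ false) → ∀ xs → any f xs ≡ false
any-false f f≗false []       = refl
any-false f f≗false (x ∷ xs) rewrite f≗false x = any-false f f≗false xs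

any-++ : ∀ {A : Set} (f : A → Bool) xs ys → any f (xs ++ ys) ≡ any f xs ∨ any f ys
any-++ f []       ys = refl
any-++ f (x ∷ xs) ys rewrite any-++ f xs ys with f x
... | true  = refl
... | false = refl

any-++ˡ : ∀ {A : Set} (f : A → Bool) xs ys → any f xs ≡ true → any f (xs ++ ys) ≡ true
any-++ˡ f xs ys e rewrite any-++ f xs ys | e = refl

map-filter : ∀ {A B : Set} (g : A → B) (p : B → Bool) xs →
             map g (filter (λ x → p (g x)) xs) ≡ filter p (map g xs)
map-filter g p []       = refl
map-filter g p (x ∷ xs) with p (g x)
... | true  = cong (g x ∷_) (map-filter g p xs)
... | false = map-filter g p xs

sum-map-+ : ∀ {A : Set} (f g : A → ℕ) xs →
            sum (map (λ x → f x N.+ g x) xs) ≡ sum (map f xs) N.+ sum (map g xs)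
sum-map-+ f g []       = refl
sum-map-+ f g (x ∷ xs) rewrite sum-map-+ f g xs =
  +-interchange (f x) (g x) (sum (map f xs)) (sum (map g xs))

sum-length-singletons : ∀ {A : Set} (F : List A) → sum (map length (map (_∷ []) F)) ≡ length F
sum-length-singletons []      = refl
sum-length-singletons (q ∷ F) = cong suc (sum-length-singletons F)

∷-last : ∀ {A : Set} (L₁ X : List A) L z → ¬ X ≡ [] → L₁ ++ X ≡ L ++ z ∷ [] →
         Σ[ K ∈ List A ] X ≡ K ++ z ∷ []
∷-last L₁ X L z X≢[] e with initLast X
... | []     = ⊥-elim (X≢[] refl)
... | K ∷ʳ′ m = K , cong (λ u → K ++ u ∷ []) (LP.∷ʳ-injectiveʳ (L₁ ++ K) L (trans (LP.++-assoc L₁ K (m ∷ [])) e))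

-- Ascents of a word

-- Words are read backwards: the head of a list is the letter inserted
-- last, so an ascent x < y of the list is a descent y > x of σ.

between : ℕ → ℕ → List ℕ → ℕ
between x y r = count (λ c → (x <ℕ c) ∧ (c <ℕ y)) r

ascentsAround : ℕ → List ℕ → ℕ
ascentsAround z (x ∷ y ∷ r) = 𝟙 ((x <ℕ z) ∧ (z <ℕ y)) + ascentsAround z (y ∷ r)
ascentsAround z _           = 0

ribbonLength : ℕ → ℕ → List ℕ → ℕ
ribbonLength x y r = if x <ℕ y then suc (between x y r + between x y r) else 0

halfArt : List ℕ → ℕ
halfArt (x ∷ y ∷ r) = halfArt (y ∷ r) + ascentsAround x (y ∷ r) + ribbonLength x y r
halfArt _           = 0

madʳ : List ℕ → ℕ
madʳ (x ∷ y ∷ r) = madʳ (y ∷ r) + (if x <ℕ y then (y ∸ x) + between x y r else 0)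
madʳ _           = 0

ascents : List ℕ → ℕ
ascents (x ∷ y ∷ r) = ascents (y ∷ r) + 𝟙 (x <ℕ y)
ascents _           = 0

ascentResidue : List ℕ → ℕ
ascentResidue (x ∷ y ∷ r) = ascentResidue (y ∷ r) + (if x <ℕ y then between x y r else 0)
ascentResidue _           = 0

ascentsBetween : List ℕ → List ℕ → ℕ
ascentsBetween u (x ∷ y ∷ r) = ascentsBetween u (y ∷ r) + (if x <ℕ y then between x y u else 0)
ascentsBetween u _           = 0

laterAscentsAround : List ℕ → ℕ
laterAscentsAround []      = 0
laterAscentsAround (x ∷ r) = laterAscentsAround r + ascentsAround x r

between-empty : ∀ x y z → (x <ℕ y) ≡ false → ((x <ℕ z) ∧ (z <ℕ y)) ≡ false
between-empty x y z x≮y with x <ℕ z in x<z | z <ℕ y in z<y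
... | true  | true  = ⊥-elim (<ℕ-false⁻¹ {x} {y} x≮y (NP.<-trans (<ℕ-true⁻¹ {x} {z} x<z) (<ℕ-true⁻¹ {z} {y} z<y)))
... | true  | false = refl
... | false | _     = refl

between-split : ∀ x y V r → (x <ℕ y) ≡ true →
                between x y ((V ++ x ∷ []) ++ y ∷ r) ≡ between x y V + between x y r
between-split x y V r x<y
  rewrite count-++ (λ c → (x <ℕ c) ∧ (c <ℕ y)) (V ++ x ∷ []) (y ∷ r)
        | count-++ (λ c → (x <ℕ c) ∧ (c <ℕ y)) V (x ∷ [])
        | count-∷ (λ c → (x <ℕ c) ∧ (c <ℕ y)) y r
        | <ℕ-irrefl x | x<y | <ℕ-irrefl y = cong (_+ between x y r) (NP.+-identityʳ _)

ascentsBetween-++ : ∀ a b R → ascentsBetween (a ++ b) R ≡ ascentsBetween a R + ascentsBetween b R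
ascentsBetween-++ a b []          = refl
ascentsBetween-++ a b (x ∷ [])    = refl
ascentsBetween-++ a b (x ∷ y ∷ r) rewrite ascentsBetween-++ a b (y ∷ r) with x <ℕ y
... | true rewrite count-++ (λ c → (x <ℕ c) ∧ (c <ℕ y)) a b =
  +-interchange (ascentsBetween a (y ∷ r)) (ascentsBetween b (y ∷ r)) _ _
... | false = +-interchange (ascentsBetween a (y ∷ r)) (ascentsBetween b (y ∷ r)) 0 0

ascentsBetween-[] : ∀ R → ascentsBetween [] R ≡ 0
ascentsBetween-[] []          = refl
ascentsBetween-[] (x ∷ [])    = refl
ascentsBetween-[] (x ∷ y ∷ r) rewrite ascentsBetween-[] (y ∷ r) with x <ℕ y
... | true  = refl
... | false = refl

ascentsBetween-[_] : ∀ z R → ascentsBetween (z ∷ []) R ≡ ascentsAround z R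
ascentsBetween-[ z ] []          = refl
ascentsBetween-[ z ] (x ∷ [])    = refl
ascentsBetween-[ z ] (x ∷ y ∷ r) rewrite ascentsBetween-[ z ] (y ∷ r) with x <ℕ y in x<y
... | true with (x <ℕ z) ∧ (z <ℕ y)
...   | true  = NP.+-comm (ascentsAround z (y ∷ r)) 1
...   | false = NP.+-comm (ascentsAround z (y ∷ r)) 0
ascentsBetween-[ z ] (x ∷ y ∷ r) | false rewrite between-empty x y z x<y =
  NP.+-comm (ascentsAround z (y ∷ r)) 0

ascentsBetween-cong : ∀ A B → (∀ a b → between a b A ≡ between a b B) →
                      ∀ R → ascentsBetween A R ≡ ascentsBetween B R
ascentsBetween-cong A B A≈B []          = refl
ascentsBetween-cong A B A≈B (x ∷ [])    = refl
ascentsBetween-cong A B A≈B (x ∷ y ∷ r)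
  rewrite ascentsBetween-cong A B A≈B (y ∷ r) | A≈B x y = refl

-- A letter between the two letters of an ascent lies either later in the
-- list (a residue) or earlier (straddled by that ascent).
ascentsBetween-suffix : ∀ V R →
  ascentsBetween (V ++ R) R ≡ ascentResidue R + laterAscentsAround R + ascentsBetween V R
ascentsBetween-suffix V []          = refl
ascentsBetween-suffix V (x ∷ [])    = refl
ascentsBetween-suffix V (x ∷ y ∷ r) = step (ascentsBetween-suffix (V ++ x ∷ []) (y ∷ r))
  where
  step : ascentsBetween ((V ++ x ∷ []) ++ y ∷ r) (y ∷ r)
           ≡ ascentResidue (y ∷ r) + laterAscentsAround (y ∷ r) + ascentsBetween (V ++ x ∷ []) (y ∷ r) →
         ascentsBetween (V ++ x ∷ y ∷ r) (x ∷ y ∷ r)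
           ≡ ascentResidue (x ∷ y ∷ r) + laterAscentsAround (x ∷ y ∷ r) + ascentsBetween V (x ∷ y ∷ r)
  step ih
    rewrite sym (LP.++-assoc V (x ∷ []) (y ∷ r)) | ih
          | ascentsBetween-++ V (x ∷ []) (y ∷ r) | ascentsBetween-[ x ] (y ∷ r)
    with x <ℕ y in x<y
  ... | true rewrite between-split x y V r x<y =
    regroup (ascentResidue (y ∷ r)) (laterAscentsAround (y ∷ r)) (ascentsAround x (y ∷ r))
            (ascentsBetween V (y ∷ r)) (between x y V) (between x y r)
    where regroup : ∀ S E d V c₁ c₂ → (S + E + (V + d)) + (c₁ + c₂) ≡ S + c₂ + (E + d) + (V + c₁)
          regroup = solveℕ
  ... | false =
    regroup (ascentResidue (y ∷ r)) (laterAscentsAround (y ∷ r)) (ascentsAround x (y ∷ r))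
            (ascentsBetween V (y ∷ r))
    where regroup : ∀ S E d V → (S + E + (V + d)) + 0 ≡ S + 0 + (E + d) + (V + 0)
          regroup = solveℕ

madʳ-decompose : ∀ n u → (∀ a b → a < b → b < n → b ∸ a ≡ suc (between a b u)) →
  ∀ R → All (_< n) R → madʳ R ≡ ascents R + ascentsBetween u R + ascentResidue R
madʳ-decompose n u gap []          _                = refl
madʳ-decompose n u gap (x ∷ [])    _                = refl
madʳ-decompose n u gap (x ∷ y ∷ r) (_ ∷ y<n ∷ r<n)
  rewrite madʳ-decompose n u gap (y ∷ r) (y<n ∷ r<n) with x <ℕ y in x<y
... | true rewrite gap x y (<ℕ-true⁻¹ x<y) y<n =
  regroup (ascents (y ∷ r)) (ascentsBetween u (y ∷ r)) (ascentResidue (y ∷ r))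
          (between x y u) (between x y r)
  where regroup : ∀ N D S c r → (N + D + S) + (suc c + r) ≡ (N + 1) + (D + c) + (S + r)
        regroup = solveℕ
... | false = regroup (ascents (y ∷ r)) (ascentsBetween u (y ∷ r)) (ascentResidue (y ∷ r))
  where regroup : ∀ N D S → (N + D + S) + 0 ≡ (N + 0) + (D + 0) + (S + 0)
        regroup = solveℕ

halfArt-decompose : ∀ R →
  halfArt R ≡ ascents R + ascentResidue R + ascentResidue R + laterAscentsAround R
halfArt-decompose []          = refl
halfArt-decompose (x ∷ [])    = refl
halfArt-decompose (x ∷ y ∷ r) rewrite halfArt-decompose (y ∷ r) with x <ℕ y
... | true = regroup (ascents (y ∷ r)) (ascentResidue (y ∷ r)) (laterAscentsAround (y ∷ r))
                     (ascentsAround x (y ∷ r)) (between x y r)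
  where regroup : ∀ N S E d c → (N + S + S + E) + d + suc (c + c)
                              ≡ (N + 1) + (S + c) + (S + c) + (E + d)
        regroup = solveℕ
... | false = regroup (ascents (y ∷ r)) (ascentResidue (y ∷ r)) (laterAscentsAround (y ∷ r))
                      (ascentsAround x (y ∷ r))
  where regroup : ∀ N S E d → (N + S + S + E) + d + 0 ≡ (N + 0) + (S + 0) + (S + 0) + (E + d)
        regroup = solveℕ

madʳ≡halfArt : ∀ n u → (∀ a b → a < b → b < n → b ∸ a ≡ suc (between a b u)) →
  ∀ R → All (_< n) R → (∀ a b → between a b u ≡ between a b R) → madʳ R ≡ halfArt R
madʳ≡halfArt n u gap R R<n u≈R = begin
  madʳ R
    ≡⟨ madʳ-decompose n u gap R R<n ⟩
  ascents R + ascentsBetween u R + ascentResidue R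
    ≡⟨ cong (λ t → ascents R + t + ascentResidue R) (begin
         ascentsBetween u R          ≡⟨ ascentsBetween-cong u R u≈R R ⟩
         ascentsBetween ([] ++ R) R  ≡⟨ ascentsBetween-suffix [] R ⟩
         ascentResidue R + laterAscentsAround R + ascentsBetween [] R
                                     ≡⟨ cong (_+_ (ascentResidue R + laterAscentsAround R)) (ascentsBetween-[] R) ⟩
         ascentResidue R + laterAscentsAround R + 0 ∎) ⟩
  ascents R + (ascentResidue R + laterAscentsAround R + 0) + ascentResidue R
    ≡⟨ regroup (ascents R) (ascentResidue R) (laterAscentsAround R) ⟩
  ascents R + ascentResidue R + ascentResidue R + laterAscentsAround R
    ≡⟨ halfArt-decompose R ⟨
  halfArt R ∎
  where
  open ≡-Reasoning
  regroup : ∀ N S E → N + (S + E + 0) + S ≡ N + S + S + E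
  regroup = solveℕ

desdif-snoc : ∀ w y x → desdif (w ++ y ∷ x ∷ []) ≡ desdif (w ++ y ∷ []) + (if x <ℕ y then y ∸ x else 0)
desdif-snoc []          y x = NP.+-identityʳ _
desdif-snoc (a ∷ [])    y x =
  trans (cong (_+_ (if y <ℕ a then a ∸ y else 0)) (NP.+-identityʳ _))
        (cong (_+ (if x <ℕ y then y ∸ x else 0)) (sym (NP.+-identityʳ _)))
desdif-snoc (a ∷ b ∷ w) y x rewrite desdif-snoc (b ∷ w) y x =
  sym (NP.+-assoc (if b <ℕ a then a ∸ b else 0) _ _)

resFrom-snoc : ∀ pre w y x → resFrom pre (w ++ y ∷ x ∷ [])
                             ≡ resFrom pre (w ++ y ∷ []) + (if x <ℕ y then between x y (pre ++ w) else 0)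
resFrom-snoc pre []          y x rewrite LP.++-identityʳ pre = NP.+-identityʳ _
resFrom-snoc pre (a ∷ [])    y x =
  trans (cong (_+_ (if y <ℕ a then between y a pre else 0)) (NP.+-identityʳ _))
        (cong (_+ (if x <ℕ y then between x y (pre ++ a ∷ []) else 0)) (sym (NP.+-identityʳ _)))
resFrom-snoc pre (a ∷ b ∷ w) y x
  rewrite resFrom-snoc (pre ++ a ∷ []) (b ∷ w) y x | LP.++-assoc pre (a ∷ []) (b ∷ w) =
  sym (NP.+-assoc (if b <ℕ a then between b a pre else 0) _ _)

mad-reverse : ∀ R → mad (reverse R) ≡ madʳ R
mad-reverse []          = refl
mad-reverse (x ∷ [])    = refl
mad-reverse (x ∷ y ∷ r) = begin
  mad (reverse (x ∷ y ∷ r))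
    ≡⟨ cong mad reverse-xyr ⟩
  mad (reverse r ++ y ∷ x ∷ [])
    ≡⟨ cong₂ _+_ (desdif-snoc (reverse r) y x) (resFrom-snoc [] (reverse r) y x) ⟩
  (desdif (reverse r ++ y ∷ []) + descent) + (res (reverse r ++ y ∷ []) + residue)
    ≡⟨ +-interchange (desdif (reverse r ++ y ∷ [])) descent (res (reverse r ++ y ∷ [])) residue ⟩
  mad (reverse r ++ y ∷ []) + (descent + residue)
    ≡⟨ cong₂ _+_ (trans (cong mad (sym (LP.unfold-reverse y r))) (mad-reverse (y ∷ r)))
                 (merge (x <ℕ y)) ⟩
  madʳ (x ∷ y ∷ r) ∎
  where
  open ≡-Reasoning
  descent = if x <ℕ y then y ∸ x else 0
  residue = if x <ℕ y then between x y (reverse r) else 0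
  reverse-xyr : reverse (x ∷ y ∷ r) ≡ reverse r ++ y ∷ x ∷ []
  reverse-xyr = begin
    reverse (x ∷ y ∷ r)          ≡⟨ LP.unfold-reverse x (y ∷ r) ⟩
    reverse (y ∷ r) ∷ʳ x         ≡⟨ cong (_∷ʳ x) (LP.unfold-reverse y r) ⟩
    (reverse r ∷ʳ y) ∷ʳ x        ≡⟨ LP.++-assoc (reverse r) (y ∷ []) (x ∷ []) ⟩
    reverse r ++ y ∷ x ∷ []      ∎
  merge : ∀ b → (if b then y ∸ x else 0) + (if b then between x y (reverse r) else 0)
              ≡ (if b then (y ∸ x) + between x y r else 0)
  merge true  = cong (_+_ (y ∸ x)) (count-reverse _ r)
  merge false = refl

-- The zig-zag tree and the word of a permutation

-- the chord of Z_n with natural label v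
chordZ : ℕ → ℕ × ℕ
chordZ v = (suc (v + v) , suc (suc (v + v)))

below : List ℕ → ℕ → ℕ
below r z = count (λ v → v <ℕ z) r

-- p_k = 2 #{j < k : σ_j < σ_k}, with the prefix σ_1 … σ_{k-1} kept reversed
zigzagSeq : List ℕ → List ℕ → List ℕ
zigzagSeq r []      = []
zigzagSeq r (x ∷ w) = (below r x + below r x) ∷ zigzagSeq (x ∷ r) w

chordsFrom-Z : ∀ n pos v → v < n →
  nthD (0 , 0) (chordsFrom pos (Z n)) v ≡ (pos + (v + v) , suc (pos + (v + v)))
chordsFrom-Z (suc n) pos zero    _ =
  cong₂ _,_ (sym (NP.+-identityʳ pos)) (cong suc (sym (NP.+-identityʳ pos)))
chordsFrom-Z (suc n) pos (suc v) (s≤s v<n) =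
  trans (chordsFrom-Z n (suc (suc pos)) v v<n) (cong (λ m → m , suc m) (shift pos v))
  where shift : ∀ p v → suc (suc p) + (v + v) ≡ p + (suc v + suc v)
        shift = solveℕ

seqFrom-chordZ : ∀ pre w → seqFrom (map chordZ pre) (map chordZ w) ≡ zigzagSeq (reverse pre) w
seqFrom-chordZ pre []      = refl
seqFrom-chordZ pre (x ∷ w) = cong₂ _∷_ (cong₂ _+_ lefts rights) rest
  where
  odd-< : ∀ {v} → suc (v + v) < suc (x + x) → v < x
  odd-< {v} p with NP.<-cmp v x
  ... | tri< v<x _ _    = v<x
  ... | tri≈ _ refl _   = ⊥-elim (NP.<-irrefl refl p)
  ... | tri> _ _ x<v    = ⊥-elim (NP.<-asym p (s≤s (NP.+-mono-< x<v x<v)))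
  lefts : count (λ c → proj₁ c <ℕ suc (x + x)) (map chordZ pre) ≡ below (reverse pre) x
  lefts = trans (count-map _ chordZ pre)
         (trans (count-cong (λ v → <ℕ-cong {suc (v + v)} odd-< (λ p → s≤s (NP.+-mono-< p p))) pre)
                (sym (count-reverse _ pre)))
  rights : count (λ c → proj₂ c <ℕ suc (x + x)) (map chordZ pre) ≡ below (reverse pre) x
  rights = trans (count-map _ chordZ pre)
          (trans (count-cong (λ v → <ℕ-cong {suc (suc (v + v))}
                                       (λ p → odd-< (NP.<-trans (NP.n<1+n _) p))
                                       (λ p → s≤s (NP.+-mono-≤-< p p))) pre)
                 (sym (count-reverse _ pre)))
  rest : seqFrom (map chordZ pre ++ chordZ x ∷ []) (map chordZ w) ≡ zigzagSeq (x ∷ reverse pre) w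
  rest = trans (cong (λ t → seqFrom t (map chordZ w)) (sym (LP.map-++ chordZ pre (x ∷ []))))
        (trans (seqFrom-chordZ (pre ++ x ∷ []) w)
               (cong (λ t → zigzagSeq t w) (LP.reverse-++ pre (x ∷ []))))

treeSeq-Z : ∀ n (σ : Permutation′ n) → treeSeq (Z n) σ ≡ zigzagSeq [] (word σ)
treeSeq-Z n σ = trans (cong (seqFrom []) labelled) (seqFrom-chordZ [] (word σ))
  where
  labelled : labeledChords (Z n) σ ≡ map chordZ (word σ)
  labelled = trans (sym (LP.map-∘ (allFin n)))
            (trans (LP.map-cong (λ i → chordsFrom-Z n 1 (toℕ (σ ⟨$⟩ʳ i)) (FP.toℕ<n _)) (allFin n))
                   (LP.map-∘ (allFin n)))

word-bounded : ∀ n (σ : Permutation′ n) → All (_< n) (word σ)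
word-bounded n σ = AllP.map⁺ (All.universal (λ i → FP.toℕ<n (σ ⟨$⟩ʳ i)) (allFin n))

word-unique : ∀ n (σ : Permutation′ n) → Unique (word σ)
word-unique n σ = Unique.map⁺ injective (Unique.allFin⁺ n)
  where
  injective : ∀ {i j} → toℕ (σ ⟨$⟩ʳ i) ≡ toℕ (σ ⟨$⟩ʳ j) → i ≡ j
  injective {i} {j} e =
    trans (sym (inverseˡ σ)) (trans (cong (σ ⟨$⟩ˡ_) (FP.toℕ-injective e)) (inverseˡ σ))

countUpTo : (ℕ → Bool) → ℕ → ℕ
countUpTo g zero    = 0
countUpTo g (suc n) = 𝟙 (g 0) + countUpTo (λ c → g (suc c)) n

count-tabulate : ∀ {A : Set} (p : A → Bool) n (f : Fin n → A) →
                 count p (tabulate f) ≡ ∑ (λ i → 𝟙 (p (f i)))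
count-tabulate p zero    f = refl
count-tabulate p (suc n) f
  rewrite count-∷ p (f Fin.zero) (tabulate (λ i → f (Fin.suc i)))
        | count-tabulate p n (λ i → f (Fin.suc i)) = refl
  where import Data.Fin as Fin

∑-countUpTo : ∀ (g : ℕ → Bool) n → ∑ (λ (i : Fin n) → 𝟙 (g (toℕ i))) ≡ countUpTo g n
∑-countUpTo g zero    = refl
∑-countUpTo g (suc n) = cong (_+_ (𝟙 (g 0))) (∑-countUpTo (λ c → g (suc c)) n)

countUpTo-+ : ∀ g h k → (∀ c → 𝟙 (g c) + 𝟙 (h c) ≡ 𝟙 (k c)) →
              ∀ n → countUpTo g n + countUpTo h n ≡ countUpTo k n
countUpTo-+ g h k g+h≡k zero    = refl
countUpTo-+ g h k g+h≡k (suc n) =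
  trans (+-interchange (𝟙 (g 0)) _ (𝟙 (h 0)) _)
        (cong₂ _+_ (g+h≡k 0) (countUpTo-+ _ _ _ (λ c → g+h≡k (suc c)) n))

countUpTo-false : ∀ n → countUpTo (λ _ → false) n ≡ 0
countUpTo-false zero    = refl
countUpTo-false (suc n) = countUpTo-false n

countUpTo-< : ∀ n b → b ≤ n → countUpTo (λ c → c <ℕ b) n ≡ b
countUpTo-< zero    zero    _         = refl
countUpTo-< (suc n) zero    _         = countUpTo-false n
countUpTo-< (suc n) (suc b) (s≤s b≤n) = cong suc (countUpTo-< n b b≤n)

count-word : ∀ n (σ : Permutation′ n) g → count g (word σ) ≡ countUpTo g n
count-word n σ g = begin
  count g (word σ)                              ≡⟨ count-map g _ (allFin n) ⟩
  count (λ i → g (toℕ (σ ⟨$⟩ʳ i))) (allFin n)   ≡⟨ count-tabulate (λ i → g (toℕ (σ ⟨$⟩ʳ i))) n (λ i → i) ⟩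
  ∑ (λ i → 𝟙 (g (toℕ (σ ⟨$⟩ʳ i))))              ≡⟨ sum-permute (λ i → 𝟙 (g (toℕ i))) σ ⟨
  ∑ (λ (i : Fin n) → 𝟙 (g (toℕ i)))                ≡⟨ ∑-countUpTo g n ⟩
  countUpTo g n                                 ∎
  where open ≡-Reasoning

𝟙-between-split : ∀ a b c → a < b →
                  𝟙 ((a <ℕ c) ∧ (c <ℕ b)) + 𝟙 (c <ℕ suc a) ≡ 𝟙 (c <ℕ b)
𝟙-between-split a b c a<b with NP.<-cmp a c
... | tri< a<c _ _
  rewrite <ℕ-true a<c | <ℕ-false {c} {suc a} (λ c≤a → NP.<⇒≱ a<c (NP.≤-pred c≤a)) = NP.+-identityʳ _
... | tri≈ _ refl _
  rewrite <ℕ-irrefl a | <ℕ-true (NP.n<1+n a) | <ℕ-true a<b = refl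
... | tri> _ _ c<a
  rewrite <ℕ-false (NP.<-asym c<a) | <ℕ-true (NP.<-trans c<a (NP.n<1+n a))
        | <ℕ-true (NP.<-trans c<a a<b) = refl

-- For a permutation every value between a and b occurs exactly once.
word-gap : ∀ n (σ : Permutation′ n) a b → a < b → b < n → b ∸ a ≡ suc (between a b (word σ))
word-gap n σ a b a<b b<n = begin
  b ∸ a               ≡⟨ cong (_∸ a) filled ⟨
  (X + suc a) ∸ a     ≡⟨ cong (_∸ a) (NP.+-suc X a) ⟩
  (suc X + a) ∸ a     ≡⟨ NP.m+n∸n≡m (suc X) a ⟩
  suc X               ≡⟨ cong suc (count-word n σ _) ⟨
  suc (between a b (word σ)) ∎
  where
  open ≡-Reasoning
  X = countUpTo (λ c → (a <ℕ c) ∧ (c <ℕ b)) n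
  filled : X + suc a ≡ b
  filled = trans (cong (_+_ X) (sym (countUpTo-< n (suc a) (NP.≤-trans a<b (NP.<⇒≤ b<n)))))
          (trans (countUpTo-+ _ (λ c → c <ℕ suc a) (λ c → c <ℕ b) (λ c → 𝟙-between-split a b c a<b) n)
                 (countUpTo-< n b (NP.<⇒≤ b<n)))

<ℤ-true : ∀ {a b} → a Z.< b → (a <ℤ b) ≡ true
<ℤ-true {a} {b} = dec-true (a Z.<? b)

<ℤ-false : ∀ {a b} → ¬ a Z.< b → (a <ℤ b) ≡ false
<ℤ-false {a} {b} = dec-false (a Z.<? b)

=ℤ-true : ∀ {a b} → a ≡ b → (a =ℤ b) ≡ true
=ℤ-true {a} {b} = dec-true (a Z.≟ b)

=ℤ-false : ∀ {a b} → ¬ a ≡ b → (a =ℤ b) ≡ false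
=ℤ-false {a} {b} = dec-false (a Z.≟ b)

=ℤ-cong : ∀ {a b c d} → (a ≡ b → c ≡ d) → (c ≡ d → a ≡ b) → (a =ℤ b) ≡ (c =ℤ d)
=ℤ-cong {a} {b} f g with a Z.≟ b
... | yes a≡b = sym (=ℤ-true (f a≡b))
... | no  a≢b = sym (=ℤ-false (λ c≡d → a≢b (g c≡d)))

≮-self : ∀ {a} → ¬ a Z.< a
≮-self = ZP.<-irrefl refl

<⇒≢ : ∀ {a b} → a Z.< b → ¬ a ≡ b
<⇒≢ a<b refl = ≮-self a<b

>⇒≢ : ∀ {a b} → b Z.< a → ¬ a ≡ b
>⇒≢ b<a refl = ≮-self b<a

i-1+1 : ∀ i → (i -ᶻ 1ℤ) +ᶻ 1ℤ ≡ i
i-1+1 = solveℤ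

i+1-1 : ∀ i → (i +ᶻ 1ℤ) -ᶻ 1ℤ ≡ i
i+1-1 = solveℤ

i-1<i : ∀ i → (i -ᶻ 1ℤ) Z.< i
i-1<i i = subst ((i -ᶻ 1ℤ) Z.<_) (ZP.+-identityʳ i) (ZP.+-monoʳ-< i {Z.- 1ℤ} {0ℤ} Z.-<+)

i<i+1 : ∀ i → i Z.< (i +ᶻ 1ℤ)
i<i+1 i = subst (Z._< (i +ᶻ 1ℤ)) (i+1-1 i) (i-1<i (i +ᶻ 1ℤ))

+1-mono-< : ∀ {i j} → i Z.< j → (i +ᶻ 1ℤ) Z.< (j +ᶻ 1ℤ)
+1-mono-< = ZP.+-monoˡ-< 1ℤ

-1-mono-< : ∀ {i j} → i Z.< j → (i -ᶻ 1ℤ) Z.< (j -ᶻ 1ℤ)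
-1-mono-< = ZP.+-monoˡ-< (Z.- 1ℤ)

<-weakenˡ : ∀ {a b} → a Z.< b → (a -ᶻ 1ℤ) Z.< b
<-weakenˡ {a} = ZP.<-trans (i-1<i a)

<-weakenʳ : ∀ {a b} → a Z.< b → a Z.< (b +ᶻ 1ℤ)
<-weakenʳ {b = b} a<b = ZP.<-trans a<b (i<i+1 b)

<-+1⇒≤ : ∀ {s t} → s Z.< t → ¬ t Z.< s +ᶻ 1ℤ
<-+1⇒≤ {s} {t} s<t t<s+1 =
  ZP.<⇒≱ t<s+1 (subst (Z._≤ t) (sym (ZP.+-comm s 1ℤ)) (ZP.i<j⇒suc[i]≤j s<t))

+1+ : ∀ a n → (a +ᶻ 1ℤ) +ᶻ n ≡ a +ᶻ (1ℤ +ᶻ n)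
+1+ = solveℤ

i<j⇒i+1≤j : ∀ {i j} → i Z.< j → i +ᶻ 1ℤ Z.≤ j
i<j⇒i+1≤j {i} i<j = subst (Z._≤ _) (ZP.+-comm 1ℤ i) (ZP.i<j⇒suc[i]≤j i<j)

i<i+suc : ∀ b d → b Z.< b +ᶻ + suc d
i<i+suc b d = ZP.<-≤-trans (i<i+1 b) (subst (b +ᶻ 1ℤ Z.≤_) (+1+ b (+ d)) (ZP.i≤i+j (b +ᶻ 1ℤ) (+ d)))

+-cancelˡ-≤ : ∀ a {m n} → a +ᶻ + m Z.≤ a +ᶻ + n → m N.≤ n
+-cancelˡ-≤ a {m} {n} le = ZP.drop‿+≤+ (subst₂ Z._≤_ (cancel a (+ m)) (cancel a (+ n)) (ZP.+-monoʳ-≤ (Z.- a) le))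
  where cancel : ∀ a x → Z.- a +ᶻ (a +ᶻ x) ≡ x
        cancel = solveℤ

+2+1 : ∀ y → (y +ᶻ + 2) +ᶻ 1ℤ ≡ y +ᶻ 1ℤ +ᶻ 1ℤ +ᶻ 1ℤ
+2+1 = solveℤ

y≢y+2 : ∀ y → ¬ y ≡ y +ᶻ 1ℤ +ᶻ 1ℤ
y≢y+2 y e = ≮-self (subst (y Z.<_) (sym e) (<-weakenʳ (i<i+1 y)))

-- Spreading

xcoord : Point → ℤ
xcoord = proj₁

shiftL shiftR raise : Point → Point
shiftL (x , y) = (x -ᶻ 1ℤ , y)
shiftR (x , y) = (x +ᶻ 1ℤ , y)
raise  (x , y) = (x , y +ᶻ + 2)

spreadPt-left : ∀ s x y → x Z.< s → spreadPt s (x , y) ≡ (x -ᶻ 1ℤ , y) ∷ []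
spreadPt-left s x y x<s rewrite <ℤ-true x<s = refl

spreadPt-right : ∀ s x y → s Z.< x → spreadPt s (x , y) ≡ (x +ᶻ 1ℤ , y) ∷ []
spreadPt-right s x y s<x rewrite <ℤ-false (ZP.<-asym s<x) | <ℤ-true s<x = refl

spreadPt-at : ∀ s y → spreadPt s (s , y) ≡ (s -ᶻ 1ℤ , y) ∷ (s , y +ᶻ 1ℤ) ∷ (s +ᶻ 1ℤ , y) ∷ []
spreadPt-at s y rewrite <ℤ-false {s} {s} ≮-self = refl

spreadPath-++ : ∀ s A B → spreadPath s (A ++ B) ≡ spreadPath s A ++ spreadPath s B
spreadPath-++ s []      B = refl
spreadPath-++ s (a ∷ A) B rewrite spreadPath-++ s A B = sym (LP.++-assoc (spreadPt s a) _ _)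

spreadPath-left : ∀ s L → All (λ p → xcoord p Z.< s) L → spreadPath s L ≡ map shiftL L
spreadPath-left s []            []         = refl
spreadPath-left s ((x , y) ∷ L) (x<s ∷ L<s)
  rewrite spreadPt-left s x y x<s | spreadPath-left s L L<s = refl

spreadPath-right : ∀ s L → All (λ p → s Z.< xcoord p) L → spreadPath s L ≡ map shiftR L
spreadPath-right s []            []         = refl
spreadPath-right s ((x , y) ∷ L) (s<x ∷ s<L)
  rewrite spreadPt-right s x y s<x | spreadPath-right s L s<L = refl

spreadPath-split : ∀ s L y R → All (λ p → xcoord p Z.< s) L → All (λ p → s Z.< xcoord p) R →
  spreadPath s (L ++ (s , y) ∷ R)
    ≡ map shiftL L ++ (s -ᶻ 1ℤ , y) ∷ (s , y +ᶻ 1ℤ) ∷ (s +ᶻ 1ℤ , y) ∷ map shiftR R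
spreadPath-split s L y R L<s s<R
  rewrite spreadPath-++ s L ((s , y) ∷ R) | spreadPath-left s L L<s
        | spreadPt-at s y | spreadPath-right s R s<R = refl

private
  consIf : Bool → Point → List Point → List Point
  consIf b p X = (if b then p ∷ [] else []) ++ X

upEnds-shiftR : ∀ P → upEnds (map shiftR P) ≡ map shiftR (upEnds P)
upEnds-shiftR []                = refl
upEnds-shiftR (p ∷ [])          = refl
upEnds-shiftR (p₀ ∷ p₁ ∷ P) = shift (proj₂ p₁ =ℤ (proj₂ p₀ +ᶻ 1ℤ)) (upEnds-shiftR (p₁ ∷ P))
  where
  shift : ∀ b {X Y} → X ≡ map shiftR Y → consIf b (shiftR p₁) X ≡ map shiftR (consIf b p₁ Y)
  shift true  e = cong (shiftR p₁ ∷_) e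
  shift false e = e

upEnds-split : ∀ A p B → upEnds (A ++ p ∷ B) ≡ upEnds (A ++ p ∷ []) ++ upEnds (p ∷ B)
upEnds-split []       p B = refl
upEnds-split (p₀ ∷ A) p B = go A p₀
  where
  append : ∀ b q {X Y} → X ≡ Y ++ upEnds (p ∷ B) → consIf b q X ≡ consIf b q Y ++ upEnds (p ∷ B)
  append true  q e = cong (q ∷_) e
  append false q e = e
  go : ∀ A p₀ → upEnds (p₀ ∷ A ++ p ∷ B) ≡ upEnds (p₀ ∷ A ++ p ∷ []) ++ upEnds (p ∷ B)
  go []       p₀ = append (proj₂ p =ℤ (proj₂ p₀ +ᶻ 1ℤ)) p refl
  go (p₁ ∷ A) p₀ = append (proj₂ p₁ =ℤ (proj₂ p₀ +ᶻ 1ℤ)) p₁ (go A p₁)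

upEnds-All : ∀ {Q : Point → Set} h P → All Q P → All Q (upEnds (h ∷ P))
upEnds-All h        []       []       = []
upEnds-All p₀ (p₁ ∷ P) (q ∷ qs) = keep (proj₂ p₁ =ℤ (proj₂ p₀ +ᶻ 1ℤ)) (upEnds-All p₁ P qs)
  where
  keep : ∀ b {X} → All _ X → All _ (consIf b p₁ X)
  keep true  qs = q ∷ qs
  keep false qs = qs

isOneBoxAt-inv : ∀ q t → isOneBoxAt q t ≡ true → t ≡ q ∷ []
isOneBoxAt-inv q (p ∷ []) e with ≡-dec Z._≟_ Z._≟_ p q
... | yes p≡q = cong (_∷ []) p≡q
isOneBoxAt-inv q (p ∷ []) () | no _

isOneBoxAt-singleton : ∀ {q t} → t ≡ q ∷ [] → isOneBoxAt q t ≡ true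
isOneBoxAt-singleton {q} refl = dec-true (≡-dec Z._≟_ Z._≟_ q q) refl

isOneBoxAt-false : ∀ q t → ¬ t ≡ q ∷ [] → isOneBoxAt q t ≡ false
isOneBoxAt-false q t t≢q with isOneBoxAt q t in e
... | true  = ⊥-elim (t≢q (isOneBoxAt-inv q t e))
... | false = refl

isOneBoxAt-cong : ∀ q t q′ t′ → (t ≡ q ∷ [] → t′ ≡ q′ ∷ []) → (t′ ≡ q′ ∷ [] → t ≡ q ∷ []) →
                  isOneBoxAt q t ≡ isOneBoxAt q′ t′
isOneBoxAt-cong q t q′ t′ f g with isOneBoxAt q t in e | isOneBoxAt q′ t′ in e′
... | true  | true  = refl
... | false | false = refl
... | true  | false with () ← trans (sym (isOneBoxAt-singleton (f (isOneBoxAt-inv q t e)))) e′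
... | false | true  with () ← trans (sym (isOneBoxAt-singleton (g (isOneBoxAt-inv q′ t′ e′)))) e

spreadPt-nonempty : ∀ s p → Σ[ a ∈ Point ] Σ[ rest ∈ List Point ] spreadPt s p ≡ a ∷ rest
spreadPt-nonempty s (x , y) with x <ℤ s
... | true = _ , _ , refl
... | false with s <ℤ x
...   | true  = _ , _ , refl
...   | false = _ , _ , refl

spreadPath-singleton⁻¹ : ∀ s t q → spreadPath s t ≡ q ∷ [] →
                         Σ[ p ∈ Point ] t ≡ p ∷ [] × spreadPt s p ≡ q ∷ []
spreadPath-singleton⁻¹ s []      q ()
spreadPath-singleton⁻¹ s (p ∷ t) q e with spreadPt-nonempty s p
... | a , rest , ep rewrite ep with LP.∷-injective e
...   | a≡q , e₂ with t
...     | [] rewrite LP.++-identityʳ rest = p , refl , trans ep (cong₂ _∷_ a≡q e₂)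
...     | p′ ∷ t′ with spreadPt-nonempty s p′
...       | a′ , rest′ , ep′ rewrite ep′ with LP.++-conicalʳ rest (a′ ∷ rest′ ++ spreadPath s t′) e₂
...         | ()

spreadPath-≢-at : ∀ s y t → ¬ spreadPath s t ≡ (s , y) ∷ []
spreadPath-≢-at s y t e with spreadPath-singleton⁻¹ s t _ e
... | (x , y′) , _ , e₂ with ZP.<-cmp x s
...   | tri< x<s _ _ rewrite spreadPt-left s x y′ x<s =
  ≮-self (subst (Z._< s) (cong proj₁ (LP.∷-injectiveˡ e₂)) (<-weakenˡ x<s))
...   | tri≈ _ refl _ rewrite spreadPt-at s y′ with LP.∷-injectiveʳ e₂
...     | ()
spreadPath-≢-at s y t e | (x , y′) , _ , e₂ | tri> _ _ s<x rewrite spreadPt-right s x y′ s<x =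
  ≮-self (subst (s Z.<_) (cong proj₁ (LP.∷-injectiveˡ e₂)) (<-weakenʳ s<x))

spreadPath-shiftR⁻¹ : ∀ s t q → s Z.< xcoord q → spreadPath s t ≡ shiftR q ∷ [] → t ≡ q ∷ []
spreadPath-shiftR⁻¹ s t (qx , qy) s<q e with spreadPath-singleton⁻¹ s t _ e
... | (x , y) , refl , e₂ with ZP.<-cmp x s
...   | tri< x<s _ _ rewrite spreadPt-left s x y x<s =
  ⊥-elim (≮-self (subst (Z._< (qx +ᶻ 1ℤ)) (cong proj₁ (LP.∷-injectiveˡ e₂))
                        (<-weakenˡ (ZP.<-trans x<s (<-weakenʳ s<q)))))
...   | tri≈ _ refl _ rewrite spreadPt-at s y with LP.∷-injectiveʳ e₂
...     | ()
spreadPath-shiftR⁻¹ s t (qx , qy) s<q e | (x , y) , refl , e₂ | tri> _ _ s<x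
  rewrite spreadPt-right s x y s<x =
  cong (_∷ []) (cong₂ _,_ (trans (sym (i+1-1 x)) (trans (cong (_-ᶻ 1ℤ) (cong proj₁ (LP.∷-injectiveˡ e₂))) (i+1-1 qx)))
                          (cong proj₂ (LP.∷-injectiveˡ e₂)))

spreadPath-shiftR : ∀ s t q → s Z.< xcoord q → t ≡ q ∷ [] → spreadPath s t ≡ shiftR q ∷ []
spreadPath-shiftR s t (qx , qy) s<q refl rewrite spreadPt-right s qx qy s<q = refl

isTopOfOneBox-spread-right : ∀ T s q → s Z.< xcoord q →
                             isTopOfOneBox (spread T s) (shiftR q) ≡ isTopOfOneBox T q
isTopOfOneBox-spread-right T s (qx , qy) s<q =
  any-map _ (spreadPath s) _
    (λ t → isOneBoxAt-cong _ _ _ _ (spreadPath-shiftR⁻¹ s t (qx , qy -ᶻ + 2) s<q)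
                                   (spreadPath-shiftR s t (qx , qy -ᶻ + 2) s<q))
    (tiles T)

isTopOfOneBox-spread-at : ∀ T s y → isTopOfOneBox (spread T s) (s , y) ≡ false
isTopOfOneBox-spread-at T s y =
  trans (any-map _ (spreadPath s) (λ _ → false) (λ t → isOneBoxAt-false _ _ (spreadPath-≢-at s _ t)) (tiles T))
        (any-false (λ _ → false) (λ _ → refl) (tiles T))

boxesAt : ℤ → Path → ℕ
boxesAt c t = count (λ p → proj₁ p =ℤ c) t

columnBoxes : Tiling → ℤ → ℕ
columnBoxes T c = sum (map (boxesAt c) (tiles T))

-- twice the art, which avoids the division
weight : Tiling → ℕ
weight T = area T N.+ numTiles T

boxesAt-triple : ∀ q₁ q₂ q₃ c → boxesAt c (q₁ ∷ q₂ ∷ q₃ ∷ [])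
                  ≡ 𝟙 (proj₁ q₁ =ℤ c) N.+ (𝟙 (proj₁ q₂ =ℤ c) N.+ (𝟙 (proj₁ q₃ =ℤ c) N.+ 0))
boxesAt-triple q₁ q₂ q₃ c
  rewrite count-∷ (λ p → proj₁ p =ℤ c) q₁ (q₂ ∷ q₃ ∷ []) | count-∷ (λ p → proj₁ p =ℤ c) q₂ (q₃ ∷ [])
        | count-∷ (λ p → proj₁ p =ℤ c) q₃ [] = refl

boxesAt-[_] : ∀ q c → boxesAt c (q ∷ []) ≡ 𝟙 (proj₁ q =ℤ c)
boxesAt-[ q ] c = trans (count-∷ (λ p → proj₁ p =ℤ c) q []) (NP.+-identityʳ _)

boxesAt-spreadPt-< : ∀ s c p → c Z.< s → boxesAt c (spreadPt s p) ≡ boxesAt (c +ᶻ 1ℤ) (p ∷ [])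
boxesAt-spreadPt-< s c (x , y) c<s with ZP.<-cmp x s
... | tri< x<s _ _ rewrite spreadPt-left s x y x<s
  | boxesAt-[ (x -ᶻ 1ℤ , y) ] c | boxesAt-[ (x , y) ] (c +ᶻ 1ℤ) =
  cong 𝟙 (=ℤ-cong (λ e → trans (sym (i-1+1 x)) (cong (_+ᶻ 1ℤ) e))
                  (λ e → trans (cong (_-ᶻ 1ℤ) e) (i+1-1 c)))
... | tri≈ _ refl _ rewrite spreadPt-at s y | boxesAt-triple (s -ᶻ 1ℤ , y) (s , y +ᶻ 1ℤ) (s +ᶻ 1ℤ , y) c
  | boxesAt-[ (s , y) ] (c +ᶻ 1ℤ)
  | =ℤ-false (>⇒≢ c<s) | =ℤ-false (>⇒≢ (<-weakenʳ c<s)) =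
  trans (NP.+-identityʳ _) (cong 𝟙 (=ℤ-cong (λ e → trans (sym (i-1+1 s)) (cong (_+ᶻ 1ℤ) e))
                                             (λ e → trans (cong (_-ᶻ 1ℤ) e) (i+1-1 c))))
... | tri> _ _ s<x rewrite spreadPt-right s x y s<x
  | =ℤ-false {x +ᶻ 1ℤ} {c} (>⇒≢ (ZP.<-trans c<s (<-weakenʳ s<x)))
  | =ℤ-false {x} {c +ᶻ 1ℤ} (λ e → <-+1⇒≤ s<x (subst (Z._< s +ᶻ 1ℤ) (sym e) (+1-mono-< c<s))) = refl

boxesAt-spreadPt-> : ∀ s c p → s Z.< c → boxesAt c (spreadPt s p) ≡ boxesAt (c -ᶻ 1ℤ) (p ∷ [])
boxesAt-spreadPt-> s c (x , y) s<c with ZP.<-cmp x s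
... | tri< x<s _ _ rewrite spreadPt-left s x y x<s
  | =ℤ-false {x -ᶻ 1ℤ} {c} (<⇒≢ (<-weakenˡ (ZP.<-trans x<s s<c)))
  | =ℤ-false {x} {c -ᶻ 1ℤ} (λ e → <-+1⇒≤ (subst (s -ᶻ 1ℤ Z.<_) (sym e) (-1-mono-< s<c))
                                          (subst (x Z.<_) (sym (i-1+1 s)) x<s)) = refl
... | tri≈ _ refl _ rewrite spreadPt-at s y | boxesAt-triple (s -ᶻ 1ℤ , y) (s , y +ᶻ 1ℤ) (s +ᶻ 1ℤ , y) c
  | boxesAt-[ (s , y) ] (c -ᶻ 1ℤ)
  | =ℤ-false (<⇒≢ (<-weakenˡ s<c)) | =ℤ-false (<⇒≢ s<c) =
  trans (NP.+-identityʳ _) (cong 𝟙 (=ℤ-cong (λ e → trans (sym (i+1-1 s)) (cong (_-ᶻ 1ℤ) e))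
                                             (λ e → trans (cong (_+ᶻ 1ℤ) e) (i-1+1 c))))
... | tri> _ _ s<x rewrite spreadPt-right s x y s<x
  | boxesAt-[ (x +ᶻ 1ℤ , y) ] c | boxesAt-[ (x , y) ] (c -ᶻ 1ℤ) =
  cong 𝟙 (=ℤ-cong (λ e → trans (sym (i+1-1 x)) (cong (_-ᶻ 1ℤ) e))
                  (λ e → trans (cong (_+ᶻ 1ℤ) e) (i-1+1 c)))

boxesAt-spreadPath : ∀ s c d → (∀ p → boxesAt c (spreadPt s p) ≡ boxesAt d (p ∷ [])) →
                     ∀ t → boxesAt c (spreadPath s t) ≡ boxesAt d t
boxesAt-spreadPath s c d pointwise []      = refl
boxesAt-spreadPath s c d pointwise (p ∷ t)
  rewrite count-++ (λ q → proj₁ q =ℤ c) (spreadPt s p) (spreadPath s t)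
        | pointwise p | boxesAt-spreadPath s c d pointwise t | boxesAt-[ p ] d
        | count-∷ (λ q → proj₁ q =ℤ d) p t = refl

columnBoxes-spread : ∀ T s c d → (∀ p → boxesAt c (spreadPt s p) ≡ boxesAt d (p ∷ [])) →
                     columnBoxes (spread T s) c ≡ columnBoxes T d
columnBoxes-spread T s c d pointwise =
  trans (cong sum (sym (LP.map-∘ (tiles T))))
        (cong sum (LP.map-cong (boxesAt-spreadPath s c d pointwise) (tiles T)))

columnBoxes-spread-< : ∀ T s c → c Z.< s → columnBoxes (spread T s) c ≡ columnBoxes T (c +ᶻ 1ℤ)
columnBoxes-spread-< T s c c<s = columnBoxes-spread T s c _ (λ p → boxesAt-spreadPt-< s c p c<s)

columnBoxes-spread-> : ∀ T s c → s Z.< c → columnBoxes (spread T s) c ≡ columnBoxes T (c -ᶻ 1ℤ)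
columnBoxes-spread-> T s c s<c = columnBoxes-spread T s c _ (λ p → boxesAt-spreadPt-> s c p s<c)

-- Spreading at s turns every box in column s into three boxes.
length-spreadPath : ∀ s t → length (spreadPath s t) ≡ length t N.+ (boxesAt s t N.+ boxesAt s t)
length-spreadPath s []      = refl
length-spreadPath s (p ∷ t)
  rewrite LP.length-++ (spreadPt s p) {spreadPath s t} | length-spreadPath s t
        | count-∷ (λ q → proj₁ q =ℤ s) p t = point p
  where
  regroup : ∀ i l c → suc (i N.+ i N.+ (l N.+ (c N.+ c))) ≡ suc (l N.+ (i N.+ c N.+ (i N.+ c)))
  regroup = solveℕ
  point : ∀ p → length (spreadPt s p) N.+ (length t N.+ (boxesAt s t N.+ boxesAt s t))
              ≡ suc (length t N.+ (𝟙 (proj₁ p =ℤ s) N.+ boxesAt s t N.+ (𝟙 (proj₁ p =ℤ s) N.+ boxesAt s t)))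
  point (x , y) with ZP.<-cmp x s
  ... | tri< x<s _ _ rewrite spreadPt-left s x y x<s | =ℤ-false (<⇒≢ x<s) = refl
  ... | tri≈ _ refl _ rewrite spreadPt-at s y | =ℤ-true {s} {s} refl =
    regroup 1 (length t) (boxesAt s t)
  ... | tri> _ _ s<x rewrite spreadPt-right s x y s<x | =ℤ-false (>⇒≢ s<x) = refl

weight-spread : ∀ T s → weight (spread T s) ≡ weight T N.+ (columnBoxes T s N.+ columnBoxes T s)
weight-spread T s rewrite LP.length-map (spreadPath s) (tiles T) =
  trans (cong (N._+ numTiles T) area′) (regroup (area T) (numTiles T) (columnBoxes T s))
  where
  regroup : ∀ a l c → a N.+ (c N.+ c) N.+ l ≡ a N.+ l N.+ (c N.+ c)
  regroup = solveℕ
  area′ : sum (map length (map (spreadPath s) (tiles T))) ≡ area T N.+ (columnBoxes T s N.+ columnBoxes T s)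
  area′ = trans (cong sum (sym (LP.map-∘ (tiles T))))
         (trans (cong sum (LP.map-cong (length-spreadPath s) (tiles T)))
         (trans (sum-map-+ length (λ t → boxesAt s t N.+ boxesAt s t) (tiles T))
                (cong (area T N.+_) (sum-map-+ (boxesAt s) (boxesAt s) (tiles T)))))

ribbon : ℤ → ℤ → Tiling → Path
ribbon s Q T = filter (strictlyBetween s Q) (upper T)

weight-addRibbon : ∀ s Q T → weight (addRibbon s Q T) ≡ weight T N.+ (length (ribbon s Q T) N.+ length (ribbon s Q T))
weight-addRibbon s Q T =
  trans (cong₂ N._+_ area′ tiles′) (regroup (area T) (numTiles T) (length F))
  where
  F = ribbon s Q T
  regroup : ∀ a l f → a N.+ f N.+ (l N.+ f) ≡ a N.+ l N.+ (f N.+ f)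
  regroup = solveℕ
  area′ : area (addRibbon s Q T) ≡ area T N.+ length F
  area′ = trans (cong sum (LP.map-++ length (tiles T) (map (_∷ []) F)))
         (trans (sum-++ (map length (tiles T)) (map length (map (_∷ []) F)))
                (cong (area T N.+_) (sum-length-singletons F)))
  tiles′ : numTiles (addRibbon s Q T) ≡ numTiles T N.+ length F
  tiles′ = trans (LP.length-++ (tiles T)) (cong (numTiles T N.+_) (LP.length-map (_∷ []) F))

columnBoxes-addRibbon : ∀ s Q T c → columnBoxes (addRibbon s Q T) c ≡ columnBoxes T c N.+ boxesAt c (ribbon s Q T)
columnBoxes-addRibbon s Q T c
  rewrite LP.map-++ (boxesAt c) (tiles T) (map (_∷ []) (ribbon s Q T))
        | sum-++ (map (boxesAt c) (tiles T)) (map (boxesAt c) (map (_∷ []) (ribbon s Q T))) =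
  cong (columnBoxes T c N.+_) (ones (ribbon s Q T))
  where
  ones : ∀ (F : Path) → sum (map (boxesAt c) (map (_∷ []) F)) ≡ boxesAt c F
  ones []      = refl
  ones (q ∷ F) rewrite ones F | boxesAt-[ q ] c = sym (count-∷ (λ p → proj₁ p =ℤ c) q F)

private
  lift : ℤ → ℤ → Point → Point
  lift s Q q = if strictlyBetween s Q q then (proj₁ q , proj₂ q +ᶻ + 2) else q

xs-addRibbon : ∀ s Q T → map proj₁ (upper (addRibbon s Q T)) ≡ map proj₁ (upper T)
xs-addRibbon s Q T = trans (sym (LP.map-∘ (upper T))) (LP.map-cong same (upper T))
  where
  same : ∀ q → proj₁ (lift s Q q) ≡ proj₁ q
  same q with strictlyBetween s Q q
  ... | true  = refl
  ... | false = refl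

lift-outside : ∀ s Q A → All (λ q → strictlyBetween s Q q ≡ false) A → map (lift s Q) A ≡ A
lift-outside s Q []      []       = refl
lift-outside s Q (q ∷ A) (e ∷ es) rewrite e = cong (q ∷_) (lift-outside s Q A es)

lift-inside : ∀ s Q A → All (λ q → strictlyBetween s Q q ≡ true) A → map (lift s Q) A ≡ map raise A
lift-inside s Q []      []       = refl
lift-inside s Q (q ∷ A) (e ∷ es) rewrite e = cong (raise q ∷_) (lift-inside s Q A es)

strictlyBetween-≤ˡ : ∀ s Q p → ¬ s Z.< xcoord p → strictlyBetween s Q p ≡ false
strictlyBetween-≤ˡ s Q (x , y) s≮x rewrite <ℤ-false {s} {x} s≮x = refl

strictlyBetween-≥ʳ : ∀ s Q p → ¬ xcoord p Z.< Q → strictlyBetween s Q p ≡ false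
strictlyBetween-≥ʳ s Q (x , y) x≮Q rewrite <ℤ-false {x} {Q} x≮Q with s <ℤ x
... | true  = refl
... | false = refl

strictlyBetween-inside : ∀ s Q p → s Z.< xcoord p → xcoord p Z.< Q → strictlyBetween s Q p ≡ true
strictlyBetween-inside s Q (x , y) s<x x<Q rewrite <ℤ-true s<x | <ℤ-true x<Q = refl

isTopOfOneBox-ribbon : ∀ ts (B : Path) →
  All (λ b → any (isOneBoxAt (xcoord b , (proj₂ b +ᶻ + 2) -ᶻ + 2)) (ts ++ map (_∷ []) B) ≡ true) B
isTopOfOneBox-ribbon ts []      = []
isTopOfOneBox-ribbon ts (b ∷ B) =
  head-top ∷ subst (λ u → All (λ b′ → any (isOneBoxAt (xcoord b′ , (proj₂ b′ +ᶻ + 2) -ᶻ + 2)) u ≡ true) B)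
               (LP.++-assoc ts ((b ∷ []) ∷ []) (map (_∷ []) B))
               (isTopOfOneBox-ribbon (ts ++ (b ∷ []) ∷ []) B)
  where
  +2-2 : ∀ y → (y +ᶻ + 2) -ᶻ + 2 ≡ y
  +2-2 = solveℤ
  head-top : any (isOneBoxAt (xcoord b , (proj₂ b +ᶻ + 2) -ᶻ + 2)) (ts ++ map (_∷ []) (b ∷ B)) ≡ true
  head-top rewrite any-++ (isOneBoxAt (xcoord b , (proj₂ b +ᶻ + 2) -ᶻ + 2)) ts (map (_∷ []) (b ∷ B))
             | +2-2 (proj₂ b) | isOneBoxAt-singleton {b} refl = ∨-zeroʳ _

isOneBoxAt-ribbon : ∀ x y (B : Path) → All (λ b → ¬ xcoord b ≡ x) B →
                    any (isOneBoxAt (x , y)) (map (_∷ []) B) ≡ false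
isOneBoxAt-ribbon x y []      []       = refl
isOneBoxAt-ribbon x y (b ∷ B) (h ∷ hs)
  rewrite isOneBoxAt-false (x , y) (b ∷ []) (λ e → h (cong proj₁ (LP.∷-injectiveˡ e))) = isOneBoxAt-ribbon x y B hs

-- The special column

maxMaybe-snoc : ∀ xs P → All (Z._≤ P) xs → maxMaybe (xs ++ P ∷ []) ≡ just P
maxMaybe-snoc []       P []         = refl
maxMaybe-snoc (x ∷ xs) P (x≤P ∷ xs≤P) rewrite maxMaybe-snoc xs P xs≤P = cong just (ZP.i≤j⇒i⊔j≡j x≤P)

-- P is the rightmost eligible column: the upper path reaches column P by
-- an up step whose end is not on top of a one-box tile, and every up step
-- further right ends on top of one.
record SpecialAt (T : Tiling) (P : ℤ) : Set where
  constructor specialAt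
  field
    left right : Path
    xₗ yₗ      : ℤ
    upper≡     : upper T ≡ left ++ (xₗ , yₗ) ∷ (P , yₗ +ᶻ 1ℤ) ∷ right
    left<P     : All (λ p → xcoord p Z.< P) (left ++ (xₗ , yₗ) ∷ [])
    P<right    : All (λ p → P Z.< xcoord p) right
    eligible   : isTopOfOneBox T (P , yₗ +ᶻ 1ℤ) ≡ false
    ineligible : All (λ q → isTopOfOneBox T q ≡ true) (upEnds ((P , yₗ +ᶻ 1ℤ) ∷ right))

special-SpecialAt : ∀ T P → SpecialAt T P → special T ≡ just P
special-SpecialAt T P (specialAt L R xₗ yₗ upper≡ left<P P<right eligible ineligible) = begin
  maxMaybe (map proj₁ (filter notTop (upEnds (upper T))))
    ≡⟨ cong (λ u → maxMaybe (map proj₁ (filter notTop u))) ends ⟩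
  maxMaybe (map proj₁ (filter notTop (upEnds (L ++ (xₗ , yₗ) ∷ []) ++ (P , yP) ∷ upEnds ((P , yP) ∷ R))))
    ≡⟨ cong (λ u → maxMaybe (map proj₁ u)) filtered ⟩
  maxMaybe (map proj₁ (F ++ (P , yP) ∷ []))
    ≡⟨ cong maxMaybe (LP.map-++ proj₁ F ((P , yP) ∷ [])) ⟩
  maxMaybe (map proj₁ F ++ P ∷ [])
    ≡⟨ maxMaybe-snoc (map proj₁ F) P
         (AllP.map⁺ (All.map ZP.<⇒≤ (filter-All notTop _ (upEnds-All′ (L ++ (xₗ , yₗ) ∷ []) left<P)))) ⟩
  just P ∎
  where
  open ≡-Reasoning
  yP = yₗ +ᶻ 1ℤ
  notTop = λ q → not (isTopOfOneBox T q)
  F = filter notTop (upEnds (L ++ (xₗ , yₗ) ∷ []))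
  upEnds-All′ : ∀ {Q : Point → Set} P → All Q P → All Q (upEnds P)
  upEnds-All′ []      []      = []
  upEnds-All′ (h ∷ P) (_ ∷ qs) = upEnds-All h P qs
  ends : upEnds (upper T) ≡ upEnds (L ++ (xₗ , yₗ) ∷ []) ++ (P , yP) ∷ upEnds ((P , yP) ∷ R)
  ends rewrite upper≡ | upEnds-split L (xₗ , yₗ) ((P , yP) ∷ R) | =ℤ-true {yP} {yP} refl = refl
  not-true : ∀ {b} → b ≡ true → not b ≡ false
  not-true refl = refl
  filtered : filter notTop (upEnds (L ++ (xₗ , yₗ) ∷ []) ++ (P , yP) ∷ upEnds ((P , yP) ∷ R))
             ≡ F ++ (P , yP) ∷ []
  filtered rewrite filter-++ notTop (upEnds (L ++ (xₗ , yₗ) ∷ [])) ((P , yP) ∷ upEnds ((P , yP) ∷ R))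
                 | eligible | filter-none notTop (upEnds ((P , yP) ∷ R)) (All.map not-true ineligible) = refl

record ColumnSplit (Up : Path) (s : ℤ) : Set where
  constructor columnSplit
  field
    before after : Path
    height       : ℤ
    Up≡          : Up ≡ before ++ (s , height) ∷ after
    before<s     : All (λ p → xcoord p Z.< s) before
    s<after      : All (λ p → s Z.< xcoord p) after

split-before : ∀ (L : Path) p R L₁ q L₂ → L ++ p ∷ R ≡ L₁ ++ q ∷ L₂ →
  All (λ a → xcoord a Z.< xcoord p) L → xcoord p Z.< xcoord q →
  Σ[ M ∈ Path ] L₁ ≡ L ++ p ∷ M × R ≡ M ++ q ∷ L₂
split-before []      p R []       q L₂ e []       p<q =
  ⊥-elim (≮-self (subst (λ u → xcoord p Z.< xcoord u) (sym (LP.∷-injectiveˡ e)) p<q))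
split-before []      p R (l ∷ L₁) q L₂ e []       p<q =
  L₁ , cong (_∷ L₁) (sym (LP.∷-injectiveˡ e)) , LP.∷-injectiveʳ e
split-before (l ∷ L) p R []       q L₂ e (l<p ∷ _) p<q =
  ⊥-elim (≮-self (ZP.<-trans (subst (λ u → xcoord u Z.< xcoord p) (LP.∷-injectiveˡ e) l<p) p<q))
split-before (l ∷ L) p R (l₁ ∷ L₁) q L₂ e (_ ∷ L<p) p<q
  with M , e₁ , e₂ ← split-before L p R L₁ q L₂ (LP.∷-injectiveʳ e) L<p p<q =
  M , cong₂ _∷_ (sym (LP.∷-injectiveˡ e)) e₁ , e₂

spread-right-of-special : ∀ T s P → SpecialAt T P → P Z.< s → ColumnSplit (upper T) s →
                          SpecialAt (spread T s) s
spread-right-of-special T s P (specialAt L R xₗ yₗ upper≡ L<P P<R _ ineligible) P<s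
                        (columnSplit L₁ L₂ ys U≡ L₁<s s<L₂) =
  specialAt (map shiftL L₁) ((s +ᶻ 1ℤ , ys) ∷ map shiftR L₂) (s -ᶻ 1ℤ) ys
    (trans (cong (spreadPath s) U≡) (spreadPath-split s L₁ ys L₂ L₁<s s<L₂))
    (AllP.++⁺ (AllP.map⁺ (All.map <-weakenˡ L₁<s)) (i-1<i s ∷ []))
    (i<i+1 s ∷ AllP.map⁺ (All.map <-weakenʳ s<L₂))
    (isTopOfOneBox-spread-at T s (ys +ᶻ 1ℤ))
    tops
  where
  yP = yₗ +ᶻ 1ℤ
  middle : Σ[ M ∈ Path ] L₁ ≡ (L ++ (xₗ , yₗ) ∷ []) ++ (P , yP) ∷ M × R ≡ M ++ (s , ys) ∷ L₂
  middle = split-before (L ++ (xₗ , yₗ) ∷ []) (P , yP) R L₁ (s , ys) L₂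
             (trans (LP.++-assoc L ((xₗ , yₗ) ∷ []) ((P , yP) ∷ R)) (trans (sym upper≡) U≡)) L<P P<s
  M = proj₁ middle
  oldTops : All (λ q → isTopOfOneBox T q ≡ true) (upEnds ((s , ys) ∷ L₂))
  oldTops = AllP.++⁻ʳ (upEnds ((P , yP) ∷ M ++ (s , ys) ∷ []))
              (subst (All _) (upEnds-split ((P , yP) ∷ M) (s , ys) L₂)
                (subst (λ u → All _ (upEnds ((P , yP) ∷ u))) (proj₂ (proj₂ middle)) ineligible))
  tops : All (λ q → isTopOfOneBox (spread T s) q ≡ true)
             (upEnds ((s , ys +ᶻ 1ℤ) ∷ (s +ᶻ 1ℤ , ys) ∷ map shiftR L₂))
  tops rewrite =ℤ-false {ys} {ys +ᶻ 1ℤ +ᶻ 1ℤ} (y≢y+2 ys) | upEnds-shiftR ((s , ys) ∷ L₂) =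
    AllP.map⁺ (All.zipWith (λ { {q} (s<q , top) → trans (isTopOfOneBox-spread-right T s q s<q) top })
                           (upEnds-All (s , ys) L₂ s<L₂ , oldTops))

record LeftOfSpecial (T : Tiling) (s P : ℤ) : Set where
  field
    before middle init right : Path
    ys xₗ yₗ                 : ℤ
    upper≡     : upper T ≡ before ++ (s , ys) ∷ middle ++ (P , yₗ +ᶻ 1ℤ) ∷ right
    last≡      : (s , ys) ∷ middle ≡ init ++ (xₗ , yₗ) ∷ []
    before<s   : All (λ p → xcoord p Z.< s) before
    s<middle   : All (λ p → s Z.< xcoord p) middle
    middle<P   : All (λ p → xcoord p Z.< P) ((s , ys) ∷ middle)
    P<right    : All (λ p → P Z.< xcoord p) right
    eligible   : isTopOfOneBox T (P , yₗ +ᶻ 1ℤ) ≡ false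
    ineligible : All (λ q → isTopOfOneBox T q ≡ true) (upEnds ((P , yₗ +ᶻ 1ℤ) ∷ right))

left-of-special : ∀ T s P → SpecialAt T P → s Z.< P → ColumnSplit (upper T) s → LeftOfSpecial T s P
left-of-special T s P (specialAt L R xₗ yₗ upper≡ L<P P<R eligible ineligible) s<P
                (columnSplit L₁ L₂ ys U≡ L₁<s s<L₂) = record
  { before = L₁ ; middle = M ; init = proj₁ last ; right = R ; ys = ys ; xₗ = xₗ ; yₗ = yₗ
  ; upper≡ = trans U≡ (cong (λ u → L₁ ++ (s , ys) ∷ u) L₂≡)
  ; last≡ = proj₂ last
  ; before<s = L₁<s
  ; s<middle = AllP.++⁻ˡ M (subst (All _) L₂≡ s<L₂)
  ; middle<P = AllP.++⁻ʳ L₁ (subst (All _) L≡ L<P)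
  ; P<right = P<R ; eligible = eligible ; ineligible = ineligible }
  where
  middle : Σ[ M ∈ Path ] L ++ (xₗ , yₗ) ∷ [] ≡ L₁ ++ (s , ys) ∷ M × L₂ ≡ M ++ (P , yₗ +ᶻ 1ℤ) ∷ R
  middle = split-before L₁ (s , ys) L₂ (L ++ (xₗ , yₗ) ∷ []) (P , yₗ +ᶻ 1ℤ) R
             (trans (sym U≡) (trans upper≡ (sym (LP.++-assoc L ((xₗ , yₗ) ∷ []) _)))) L₁<s s<P
  M = proj₁ middle
  L≡ = proj₁ (proj₂ middle)
  L₂≡ = proj₂ (proj₂ middle)
  last = ∷-last L₁ ((s , ys) ∷ M) L (xₗ , yₗ) (λ ()) (sym L≡)

module _ {T s P} (S : LeftOfSpecial T s P) where
  open LeftOfSpecial S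

  private
    Q yP : ℤ
    Q = P +ᶻ 1ℤ
    yP = yₗ +ᶻ 1ℤ
    K : Path
    K = (s , ys) ∷ middle
    s<Q : s Z.< Q
    s<Q = <-weakenʳ (All.head middle<P)
    shiftedK<Q : All (λ p → xcoord p Z.< Q) (map shiftR K)
    shiftedK<Q = AllP.map⁺ (All.map +1-mono-< middle<P)
    s<shiftedK : All (λ p → s Z.< xcoord p) (map shiftR K)
    s<shiftedK = AllP.map⁺ {xs = K} (i<i+1 s ∷ All.map <-weakenʳ s<middle)
    Q<shiftedRight : All (λ p → Q Z.< xcoord p) (map shiftR right)
    Q<shiftedRight = AllP.map⁺ (All.map +1-mono-< P<right)
    shiftedBefore<s : All (λ p → xcoord p Z.< s) (map shiftL before ++ (s -ᶻ 1ℤ , ys) ∷ [])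
    shiftedBefore<s = AllP.++⁺ (AllP.map⁺ (All.map <-weakenˡ before<s)) (i-1<i s ∷ [])

  upper-spread-left : upper (spread T s)
    ≡ (map shiftL before ++ (s -ᶻ 1ℤ , ys) ∷ []) ++ (s , ys +ᶻ 1ℤ) ∷ map shiftR K ++ (Q , yP) ∷ map shiftR right
  upper-spread-left = begin
    spreadPath s (upper T)
      ≡⟨ cong (spreadPath s) upper≡ ⟩
    spreadPath s (before ++ (s , ys) ∷ middle ++ (P , yP) ∷ right)
      ≡⟨ spreadPath-split s before ys (middle ++ (P , yP) ∷ right) before<s
           (AllP.++⁺ s<middle (All.head middle<P ∷ All.map (ZP.<-trans (All.head middle<P)) P<right)) ⟩
    map shiftL before ++ (s -ᶻ 1ℤ , ys) ∷ (s , ys +ᶻ 1ℤ) ∷ map shiftR (K ++ (P , yP) ∷ right)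
      ≡⟨ cong (λ u → map shiftL before ++ (s -ᶻ 1ℤ , ys) ∷ (s , ys +ᶻ 1ℤ) ∷ u) (LP.map-++ shiftR K _) ⟩
    map shiftL before ++ (s -ᶻ 1ℤ , ys) ∷ (s , ys +ᶻ 1ℤ) ∷ map shiftR K ++ (Q , yP) ∷ map shiftR right
      ≡⟨ LP.++-assoc (map shiftL before) ((s -ᶻ 1ℤ , ys) ∷ []) _ ⟨
    (map shiftL before ++ (s -ᶻ 1ℤ , ys) ∷ []) ++ (s , ys +ᶻ 1ℤ) ∷ map shiftR K ++ (Q , yP) ∷ map shiftR right ∎
    where open ≡-Reasoning

  spread-left-of-special : SpecialAt (spread T s) Q
  spread-left-of-special =
    specialAt (map shiftL before ++ (s -ᶻ 1ℤ , ys) ∷ (s , ys +ᶻ 1ℤ) ∷ map shiftR init) (map shiftR right)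
              (xₗ +ᶻ 1ℤ) yₗ
      (trans upper-spread-left regroup)
      (subst (All (λ p → xcoord p Z.< Q)) regroup-left
        (AllP.++⁺ (All.map (λ p<s → ZP.<-trans p<s s<Q) shiftedBefore<s)
                  (s<Q ∷ subst (All _) shiftedK≡ shiftedK<Q)))
      Q<shiftedRight
      (trans (isTopOfOneBox-spread-right T s (P , yP) (All.head middle<P)) eligible)
      (subst (All _) (sym (upEnds-shiftR ((P , yP) ∷ right)))
        (AllP.map⁺ (All.zipWith (λ { {q} (P<q , top) →
                       trans (isTopOfOneBox-spread-right T s q (ZP.<-trans (All.head middle<P) P<q)) top })
                     (upEnds-All (P , yP) right P<right , ineligible))))
    where
    shiftedK≡ : map shiftR K ≡ map shiftR init ++ (xₗ +ᶻ 1ℤ , yₗ) ∷ []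
    shiftedK≡ = trans (cong (map shiftR) last≡) (LP.map-++ shiftR init _)
    B = map shiftL before
    a₀ = (s -ᶻ 1ℤ , ys)
    b₀ = (s , ys +ᶻ 1ℤ)
    I = map shiftR init
    z = (xₗ +ᶻ 1ℤ , yₗ)
    regroup : (B ++ a₀ ∷ []) ++ b₀ ∷ map shiftR K ++ (Q , yP) ∷ map shiftR right
            ≡ (B ++ a₀ ∷ b₀ ∷ I) ++ z ∷ (Q , yP) ∷ map shiftR right
    regroup = trans (LP.++-assoc B (a₀ ∷ []) _)
             (trans (cong (λ u → B ++ a₀ ∷ b₀ ∷ u)
                          (trans (cong (_++ (Q , yP) ∷ map shiftR right) shiftedK≡) (LP.++-assoc I (z ∷ []) _)))
                    (sym (LP.++-assoc B (a₀ ∷ b₀ ∷ I) _)))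
    regroup-left : (B ++ a₀ ∷ []) ++ b₀ ∷ I ++ z ∷ [] ≡ (B ++ a₀ ∷ b₀ ∷ I) ++ z ∷ []
    regroup-left = trans (LP.++-assoc B (a₀ ∷ []) _) (sym (LP.++-assoc B (a₀ ∷ b₀ ∷ I) (z ∷ [])))

  private
    notBetween-left : All (λ p → strictlyBetween s Q p ≡ false) (map shiftL before ++ (s -ᶻ 1ℤ , ys) ∷ [])
    notBetween-left = All.map (λ {p} p<s → strictlyBetween-≤ˡ s Q p (ZP.<-asym p<s)) shiftedBefore<s
    between-K : All (λ p → strictlyBetween s Q p ≡ true) (map shiftR K)
    between-K = All.zipWith (λ { {p} (s<p , p<Q) → strictlyBetween-inside s Q p s<p p<Q }) (s<shiftedK , shiftedK<Q)
    notBetween-right : All (λ p → strictlyBetween s Q p ≡ false) (map shiftR right)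
    notBetween-right = All.map (λ {p} Q<p → strictlyBetween-≥ʳ s Q p (ZP.<-asym Q<p)) Q<shiftedRight
    notBetween-s : strictlyBetween s Q (s , ys +ᶻ 1ℤ) ≡ false
    notBetween-s = strictlyBetween-≤ˡ s Q (s , ys +ᶻ 1ℤ) ≮-self
    notBetween-Q : strictlyBetween s Q (Q , yP) ≡ false
    notBetween-Q = strictlyBetween-≥ʳ s Q (Q , yP) ≮-self

  ribbon-left-of-special : ribbon s Q (spread T s) ≡ map shiftR K
  ribbon-left-of-special
    rewrite upper-spread-left
          | filter-++ (strictlyBetween s Q) (map shiftL before ++ (s -ᶻ 1ℤ , ys) ∷ [])
                      ((s , ys +ᶻ 1ℤ) ∷ map shiftR K ++ (Q , yP) ∷ map shiftR right)
          | filter-none (strictlyBetween s Q) _ notBetween-left | notBetween-s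
          | filter-++ (strictlyBetween s Q) (map shiftR K) ((Q , yP) ∷ map shiftR right)
          | filter-all (strictlyBetween s Q) (map shiftR K) between-K | notBetween-Q
          | filter-none (strictlyBetween s Q) (map shiftR right) notBetween-right =
    LP.++-identityʳ (map shiftR K)

  private
    T″ : Tiling
    T″ = addRibbon s Q (spread T s)
    raised≡ : map raise (map shiftR K) ≡ map raise (map shiftR init) ++ (xₗ +ᶻ 1ℤ , yₗ +ᶻ + 2) ∷ []
    raised≡ = trans (cong (map raise) (trans (cong (map shiftR) last≡) (LP.map-++ shiftR init _)))
                    (LP.map-++ raise (map shiftR init) _)

  upper-addRibbon-left : upper T″
    ≡ (map shiftL before ++ (s -ᶻ 1ℤ , ys) ∷ []) ++ (s , ys +ᶻ 1ℤ) ∷ map raise (map shiftR K) ++ (Q , yP) ∷ map shiftR right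
  upper-addRibbon-left =
    trans (cong (map (lift s Q)) upper-spread-left)
   (trans (LP.map-++ (lift s Q) A _)
          (cong₂ _++_ (lift-outside s Q A notBetween-left)
            (cong₂ _∷_ (cong (λ b → if b then (s , (ys +ᶻ 1ℤ) +ᶻ + 2) else (s , ys +ᶻ 1ℤ)) notBetween-s)
              (trans (LP.map-++ (lift s Q) (map shiftR K) _)
                (cong₂ _++_ (lift-inside s Q (map shiftR K) between-K)
                  (cong₂ _∷_ (cong (λ b → if b then (Q , yP +ᶻ + 2) else (Q , yP)) notBetween-Q)
                             (lift-outside s Q (map shiftR right) notBetween-right)))))))
    where A = map shiftL before ++ (s -ᶻ 1ℤ , ys) ∷ []

  eligible-addRibbon-left : isTopOfOneBox T″ (s , ys +ᶻ 1ℤ) ≡ false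
  eligible-addRibbon-left =
    trans (any-++ _ (tiles (spread T s)) _)
      (cong₂ _∨_ (isTopOfOneBox-spread-at T s (ys +ᶻ 1ℤ))
        (trans (cong (λ u → any (isOneBoxAt (s , (ys +ᶻ 1ℤ) -ᶻ + 2)) (map (_∷ []) u)) ribbon-left-of-special)
               (isOneBoxAt-ribbon s _ (map shiftR K) (All.map (λ s<p e → ≮-self (subst (s Z.<_) e s<p)) s<shiftedK))))

  -- The ribbon puts a one-box tile under every raised point, and the up
  -- steps right of Q still end on the one-box tiles they ended on before.
  ineligible-addRibbon-left :
    All (λ q → isTopOfOneBox T″ q ≡ true) (upEnds ((s , ys +ᶻ 1ℤ) ∷ map raise (map shiftR K) ++ (Q , yP) ∷ map shiftR right))
  ineligible-addRibbon-left =
    subst (λ L → All Top (upEnds L)) (sym regroup)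
      (subst (All Top) (sym (upEnds-split ((s , ys +ᶻ 1ℤ) ∷ map raise (map shiftR init)) z Rr))
        (AllP.++⁺ (subst (λ u → All Top (upEnds ((s , ys +ᶻ 1ℤ) ∷ u))) raised≡
                         (upEnds-All (s , ys +ᶻ 1ℤ) (map raise (map shiftR K)) (AllP.map⁺ raisedTops)))
                  (subst (All Top) (sym skip-z) oldTops)))
    where
    Top : Point → Set
    Top q = isTopOfOneBox T″ q ≡ true
    z = (xₗ +ᶻ 1ℤ , yₗ +ᶻ + 2)
    Rr = (Q , yP) ∷ map shiftR right
    raisedTops : All (λ b → Top (raise b)) (map shiftR K)
    raisedTops rewrite ribbon-left-of-special = isTopOfOneBox-ribbon (tiles (spread T s)) (map shiftR K)
    oldTops : All Top (upEnds Rr)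
    oldTops = All.map (λ top → any-++ˡ _ (tiles (spread T s)) _ top) (SpecialAt.ineligible spread-left-of-special)
    regroup : (s , ys +ᶻ 1ℤ) ∷ map raise (map shiftR K) ++ Rr ≡ ((s , ys +ᶻ 1ℤ) ∷ map raise (map shiftR init)) ++ z ∷ Rr
    regroup = cong ((s , ys +ᶻ 1ℤ) ∷_)
                (trans (cong (_++ Rr) raised≡) (LP.++-assoc (map raise (map shiftR init)) (z ∷ []) Rr))
    skip-z : upEnds (z ∷ Rr) ≡ upEnds Rr
    skip-z rewrite =ℤ-false {yP} {(yₗ +ᶻ + 2) +ᶻ 1ℤ} (λ e → y≢y+2 yP (trans e (+2+1 yₗ))) = refl

  addRibbon-left-of-special : SpecialAt T″ s
  addRibbon-left-of-special =
    specialAt (map shiftL before) (map raise (map shiftR K) ++ (Q , yP) ∷ map shiftR right) (s -ᶻ 1ℤ) ys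
      (trans upper-addRibbon-left (LP.++-assoc (map shiftL before) ((s -ᶻ 1ℤ , ys) ∷ []) _))
      shiftedBefore<s
      (AllP.++⁺ (AllP.map⁺ s<shiftedK) (s<Q ∷ All.map (ZP.<-trans s<Q) Q<shiftedRight))
      eligible-addRibbon-left
      ineligible-addRibbon-left

range : ℤ → ℕ → List ℤ
range a zero    = []
range a (suc m) = a ∷ range (a +ᶻ 1ℤ) m

empty-interval : ∀ {a c} → a Z.≤ c → ¬ c Z.< a +ᶻ + 0
empty-interval {a} {c} a≤c c<a+0 = ZP.<⇒≱ (subst (c Z.<_) (ZP.+-identityʳ a) c<a+0) a≤c

range-> : ∀ a m → All (a Z.<_) (range (a +ᶻ 1ℤ) m)
range-> a zero    = []
range-> a (suc m) = i<i+1 a ∷ All.map (ZP.<-trans (i<i+1 a)) (range-> (a +ᶻ 1ℤ) m)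

range-≥ : ∀ a m → All (a Z.≤_) (range a m)
range-≥ a zero    = []
range-≥ a (suc m) = ZP.≤-refl ∷ All.map ZP.<⇒≤ (range-> a m)

range-< : ∀ a m → All (Z._< a +ᶻ + m) (range a m)
range-< a zero    = []
range-< a (suc m) =
  subst (a Z.<_) (+1+ a (+ m)) (ZP.<-≤-trans (i<i+1 a) (ZP.i≤i+j (a +ᶻ 1ℤ) (+ m)))
  ∷ subst (λ u → All (Z._< u) (range (a +ᶻ 1ℤ) m)) (+1+ a (+ m)) (range-< (a +ᶻ 1ℤ) m)

length-range : ∀ a m → length (range a m) ≡ m
length-range a zero    = refl
length-range a (suc m) = cong suc (length-range (a +ᶻ 1ℤ) m)

range-+1 : ∀ a m → map (_+ᶻ 1ℤ) (range a m) ≡ range (a +ᶻ 1ℤ) m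
range-+1 a zero    = refl
range-+1 a (suc m) = cong ((a +ᶻ 1ℤ) ∷_) (range-+1 (a +ᶻ 1ℤ) m)

range-split : ∀ s m a Up → map proj₁ Up ≡ range a m → a Z.≤ s → s Z.< a +ᶻ + m → ColumnSplit Up s
range-split s zero    a Up             Up≡ a≤s s<a+m = ⊥-elim (empty-interval a≤s s<a+m)
range-split s (suc m) a []             () a≤s s<a+m
range-split s (suc m) a ((x , y) ∷ Up) Up≡ a≤s s<a+m with LP.∷-injectiveˡ Up≡
... | refl with ZP.<-cmp x s
...   | tri< x<s _ _ =
  let columnSplit L₁ L₂ ys Up≡′ L₁<s s<L₂ =
        range-split s m (x +ᶻ 1ℤ) Up (LP.∷-injectiveʳ Up≡) (i<j⇒i+1≤j x<s) (subst (s Z.<_) (sym (+1+ x (+ m))) s<a+m)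
  in columnSplit ((x , y) ∷ L₁) L₂ ys (cong ((x , y) ∷_) Up≡′) (x<s ∷ L₁<s) s<L₂
...   | tri≈ _ refl _ =
  columnSplit [] Up y refl [] (AllP.map⁻ (subst (All (s Z.<_)) (sym (LP.∷-injectiveʳ Up≡)) (range-> s m)))
...   | tri> _ _ s<x = ⊥-elim (ZP.<⇒≱ s<x a≤s)

xs-spreadPath : ∀ s m a Up → map proj₁ Up ≡ range a m → a Z.≤ s → s Z.< a +ᶻ + m →
                map proj₁ (spreadPath s Up) ≡ range (a -ᶻ 1ℤ) (suc (suc m))
xs-spreadPath s zero    a Up             Up≡ a≤s s<a+m = ⊥-elim (empty-interval a≤s s<a+m)
xs-spreadPath s (suc m) a []             () a≤s s<a+m
xs-spreadPath s (suc m) a ((x , y) ∷ Up) Up≡ a≤s s<a+m with LP.∷-injectiveˡ Up≡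
... | refl with ZP.<-cmp x s
...   | tri< x<s _ _ rewrite spreadPt-left s x y x<s =
  cong ((x -ᶻ 1ℤ) ∷_)
    (trans (xs-spreadPath s m (x +ᶻ 1ℤ) Up (LP.∷-injectiveʳ Up≡) (i<j⇒i+1≤j x<s) (subst (s Z.<_) (sym (+1+ x (+ m))) s<a+m))
           (cong (λ u → range u (suc (suc m))) (trans (i+1-1 x) (sym (i-1+1 x)))))
...   | tri≈ _ refl _
  rewrite spreadPt-at s y
        | spreadPath-right s Up (AllP.map⁻ (subst (All (s Z.<_)) (sym (LP.∷-injectiveʳ Up≡)) (range-> s m)))
        | i-1+1 s =
  cong (λ u → (s -ᶻ 1ℤ) ∷ s ∷ (s +ᶻ 1ℤ) ∷ u)
    (trans (sym (LP.map-∘ Up)) (trans (LP.map-∘ Up)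
      (trans (cong (map (_+ᶻ 1ℤ)) (LP.∷-injectiveʳ Up≡)) (range-+1 (s +ᶻ 1ℤ) m))))
...   | tri> _ _ s<x = ⊥-elim (ZP.<⇒≱ s<x a≤s)

count-range-inside : ∀ m a c → a Z.≤ c → c Z.< a +ᶻ + m → count (_=ℤ c) (range a m) ≡ 1
count-range-inside zero    a c a≤c c<a+m = ⊥-elim (empty-interval a≤c c<a+m)
count-range-inside (suc m) a c a≤c c<a+m with ZP.<-cmp a c
... | tri< a<c _ _ rewrite count-∷ (_=ℤ c) a (range (a +ᶻ 1ℤ) m) | =ℤ-false (<⇒≢ a<c) =
  count-range-inside m (a +ᶻ 1ℤ) c (i<j⇒i+1≤j a<c) (subst (c Z.<_) (sym (+1+ a (+ m))) c<a+m)
... | tri≈ _ refl _ rewrite count-∷ (_=ℤ a) a (range (a +ᶻ 1ℤ) m) | =ℤ-true {a} refl =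
  cong suc (count-none _ _ (All.map (λ a<x → =ℤ-false (>⇒≢ a<x)) (range-> a m)))
... | tri> _ _ c<a = ⊥-elim (ZP.<⇒≱ c<a a≤c)

count-range-below : ∀ m a c → c Z.< a → count (_=ℤ c) (range a m) ≡ 0
count-range-below m a c c<a = count-none _ _ (All.map (λ a≤x → =ℤ-false (>⇒≢ (ZP.<-≤-trans c<a a≤x))) (range-≥ a m))

count-range-above : ∀ m a c → a +ᶻ + m Z.≤ c → count (_=ℤ c) (range a m) ≡ 0
count-range-above m a c a+m≤c = count-none _ _ (All.map (λ x<a+m → =ℤ-false (<⇒≢ (ZP.<-≤-trans x<a+m a+m≤c))) (range-< a m))

filter-range-prefix : ∀ s b d m → s Z.< b → d N.≤ m →
  filter (λ x → (s <ℤ x) ∧ (x <ℤ (b +ᶻ + d))) (range b m) ≡ range b d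
filter-range-prefix s b zero m s<b _ =
  filter-none _ (range b m)
    (All.map (λ {x} b≤x → trans (cong ((s <ℤ x) ∧_) (<ℤ-false (ZP.≤⇒≯ (subst (Z._≤ x) (sym (ZP.+-identityʳ b)) b≤x))))
                                (∧-zeroʳ (s <ℤ x)))
             (range-≥ b m))
filter-range-prefix s b (suc d) (suc m) s<b (N.s≤s d≤m)
  rewrite <ℤ-true s<b
        | <ℤ-true (i<i+suc b d)
        | sym (+1+ b (+ d)) =
  cong (b ∷_) (filter-range-prefix s (b +ᶻ 1ℤ) d m (<-weakenʳ s<b) d≤m)

filter-range : ∀ s d m a → a Z.≤ s +ᶻ 1ℤ → (s +ᶻ 1ℤ) +ᶻ + d Z.≤ a +ᶻ + m →
  filter (λ x → (s <ℤ x) ∧ (x <ℤ ((s +ᶻ 1ℤ) +ᶻ + d))) (range a m) ≡ range (s +ᶻ 1ℤ) d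
filter-range s zero    zero    a a≤s+1 _ = refl
filter-range s (suc d) zero    a a≤s+1 le =
  ⊥-elim (ZP.<⇒≱ (i<i+suc (s +ᶻ 1ℤ) d) (ZP.≤-trans (subst (_ Z.≤_) (ZP.+-identityʳ a) le) a≤s+1))
filter-range s d (suc m) a a≤s+1 le with ZP.<-cmp a (s +ᶻ 1ℤ)
... | tri< a<s+1 _ _ rewrite <ℤ-false {s} {a} (λ s<a → <-+1⇒≤ s<a a<s+1) =
  filter-range s d m (a +ᶻ 1ℤ) (i<j⇒i+1≤j a<s+1) (subst (_ Z.≤_) (sym (+1+ a (+ m))) le)
... | tri≈ _ refl _ = filter-range-prefix s (s +ᶻ 1ℤ) d (suc m) (i<i+1 s) (+-cancelˡ-≤ (s +ᶻ 1ℤ) le)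
... | tri> _ _ s+1<a = ⊥-elim (ZP.<⇒≱ s+1<a a≤s+1)

xs-ribbon : ∀ s d m a T → map proj₁ (upper T) ≡ range a m → a Z.≤ s +ᶻ 1ℤ → (s +ᶻ 1ℤ) +ᶻ + d Z.≤ a +ᶻ + m →
            map proj₁ (ribbon s ((s +ᶻ 1ℤ) +ᶻ + d) T) ≡ range (s +ᶻ 1ℤ) d
xs-ribbon s d m a T xs≡ a≤ ≤a+m =
  trans (map-filter proj₁ (λ x → (s <ℤ x) ∧ (x <ℤ ((s +ᶻ 1ℤ) +ᶻ + d))) (upper T))
        (trans (cong (filter _) xs≡) (filter-range s d m a a≤ ≤a+m))

-- The growth along the word

below-∷ : ∀ x r z → below (x ∷ r) z ≡ 𝟙 (x <ℕ z) + below r z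
below-∷ x r z = count-∷ (λ v → v <ℕ z) x r

below-∷-self : ∀ x r → below (x ∷ r) x ≡ below r x
below-∷-self x r = trans (below-∷ x r x) (cong (λ b → 𝟙 b + below r x) (<ℕ-irrefl x))

below-mono : ∀ r {z x} → z ≤ x → below r z ≤ below r x
below-mono r z≤x = count-mono _ _ (λ v v<z → <ℕ-true (NP.<-≤-trans (<ℕ-true⁻¹ v<z) z≤x)) r

below-strict : ∀ r {y z} → y ∈ r → y < z → below r y < below r z
below-strict (v ∷ r) {y} {z} (here refl) y<z
  rewrite below-∷ y r y | below-∷ y r z | <ℕ-irrefl y | <ℕ-true y<z = s≤s (below-mono r (NP.<⇒≤ y<z))
below-strict (v ∷ r) {y} {z} (there y∈r) y<z
  rewrite below-∷ v r y | below-∷ v r z =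
  NP.+-mono-≤-< (𝟙-mono (λ v<y → <ℕ-true (NP.<-trans (<ℕ-true⁻¹ v<y) y<z))) (below-strict r y∈r y<z)
  where
  𝟙-mono : ∀ {b c} → (b ≡ true → c ≡ true) → 𝟙 b ≤ 𝟙 c
  𝟙-mono {true}  b⇒c rewrite b⇒c refl = s≤s z≤n
  𝟙-mono {false} b⇒c = z≤n

below-split : ∀ r x y → x < y → x ∉ r → below r y ≡ below r x + between x y r
below-split []      x y x<y x∉r = refl
below-split (v ∷ r) x y x<y x∉r
  rewrite below-∷ v r y | below-∷ v r x | count-∷ (λ c → (x <ℕ c) ∧ (c <ℕ y)) v r
        | below-split r x y x<y (λ x∈r → x∉r (there x∈r)) =
  trans (cong (_+ (below r x + between x y r)) (point (λ v≡x → x∉r (here (sym v≡x)))))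
        (+-interchange (𝟙 (v <ℕ x)) _ (below r x) (between x y r))
  where
  point : ¬ v ≡ x → 𝟙 (v <ℕ y) ≡ 𝟙 (v <ℕ x) + 𝟙 ((x <ℕ v) ∧ (v <ℕ y))
  point v≢x with NP.<-cmp v x
  ... | tri< v<x _ _ rewrite <ℕ-true v<x | <ℕ-true (NP.<-trans v<x x<y) | <ℕ-false (NP.<-asym v<x) = refl
  ... | tri≈ _ v≡x _ = ⊥-elim (v≢x v≡x)
  ... | tri> _ _ x<v rewrite <ℕ-false (NP.<-asym x<v) | <ℕ-true x<v with v <ℕ y
  ...   | true  = refl
  ...   | false = refl

-- p − (k − 1) for the next letter z, r being the reversed prefix of length k − 1
column : List ℕ → ℕ → ℤ
column r z = + (below r z + below r z) -ᶻ + length r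

-[1+k]+1 : ∀ X k → (X -ᶻ (1ℤ +ᶻ k)) +ᶻ 1ℤ ≡ X -ᶻ k
-[1+k]+1 = solveℤ

column-mono : ∀ r {z x} → z ≤ x → column r z Z.≤ column r x
column-mono r z≤x =
  ZP.+-monoˡ-≤ (Z.- + length r) (Z.+≤+ (NP.+-mono-≤ (below-mono r z≤x) (below-mono r z≤x)))

column-∷-< : ∀ x r z → z < x → column (x ∷ r) z +ᶻ 1ℤ ≡ column r z
column-∷-< x r z z<x
  rewrite below-∷ x r z | <ℕ-false (NP.<-asym z<x) = -[1+k]+1 (+ (below r z + below r z)) (+ length r)

column-∷-self : ∀ x r → column (x ∷ r) x +ᶻ 1ℤ ≡ column r x
column-∷-self x r rewrite below-∷-self x r = -[1+k]+1 (+ (below r x + below r x)) (+ length r)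

column-∷-> : ∀ x r z → x < z → column (x ∷ r) z ≡ column r z +ᶻ 1ℤ
column-∷-> x r z x<z rewrite below-∷ x r z | <ℕ-true x<z | NP.+-suc (below r z) (below r z) =
  shift (+ (below r z + below r z)) (+ length r)
  where shift : ∀ X k → (1ℤ +ᶻ (1ℤ +ᶻ X)) -ᶻ (1ℤ +ᶻ k) ≡ (X -ᶻ k) +ᶻ 1ℤ
        shift = solveℤ

column-between : ∀ r x y → x < y → x ∉ r →
                 column (y ∷ r) y ≡ column (y ∷ r) x +ᶻ + (between x y r + between x y r)
column-between r x y x<y x∉r
  rewrite below-∷-self y r | below-∷ y r x | <ℕ-false (NP.<-asym x<y) | below-split r x y x<y x∉r
        | ZP.pos-+ (below r x + between x y r) (below r x + between x y r)
        | ZP.pos-+ (below r x) (between x y r) | ZP.pos-+ (below r x + below r x) (between x y r + between x y r)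
        | ZP.pos-+ (below r x) (below r x) | ZP.pos-+ (between x y r) (between x y r) =
  regroup (+ below r x) (+ between x y r) (+ length (y ∷ r))
  where regroup : ∀ a c k → ((a +ᶻ c) +ᶻ (a +ᶻ c)) -ᶻ k ≡ ((a +ᶻ a) -ᶻ k) +ᶻ (c +ᶻ c)
        regroup = solveℤ

column-head-< : ∀ y r x → y < x → column (y ∷ r) y +ᶻ 1ℤ Z.< column (y ∷ r) x
column-head-< y r x y<x =
  subst (Z._< column (y ∷ r) x) (sym (shift (+ (b + b)) (+ length (y ∷ r))))
    (ZP.+-monoˡ-< (Z.- + length (y ∷ r)) (Z.+<+ (NP.+-mono-≤-< b<a b<a)))
  where
  a = below (y ∷ r) x
  b = below (y ∷ r) y
  b<a : b < a
  b<a = below-strict (y ∷ r) (here refl) y<x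
  shift : ∀ X K → (X -ᶻ K) +ᶻ 1ℤ ≡ (1ℤ +ᶻ X) -ᶻ K
  shift = solveℤ

columnBoxes-spread-column : ∀ T x r z → ¬ z ≡ x →
  columnBoxes (spread T (column r x)) (column (x ∷ r) z) ≡ columnBoxes T (column r z)
columnBoxes-spread-column T x r z z≢x with NP.<-cmp z x
... | tri< z<x _ _ =
  trans (columnBoxes-spread-< T _ _ left) (cong (columnBoxes T) (column-∷-< x r z z<x))
  where
  left : column (x ∷ r) z Z.< column r x
  left = ZP.<-≤-trans (subst (column (x ∷ r) z Z.<_) (column-∷-< x r z z<x) (i<i+1 _))
                      (column-mono r (NP.<⇒≤ z<x))
... | tri≈ _ z≡x _ = ⊥-elim (z≢x z≡x)
... | tri> _ _ x<z =
  trans (columnBoxes-spread-> T _ _ right)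
        (cong (columnBoxes T) (trans (cong (_-ᶻ 1ℤ) (column-∷-> x r z x<z)) (i+1-1 _)))
  where
  right : column r x Z.< column (x ∷ r) z
  right = ZP.≤-<-trans (column-mono r (NP.<⇒≤ x<z))
                       (subst (column r z Z.<_) (sym (column-∷-> x r z x<z)) (i<i+1 _))

ribbonGrow-special : ∀ T s Q → special (spread T s) ≡ just Q →
  ribbonGrow T s ≡ (if s <ℤ Q then addRibbon s Q (spread T s) else spread T s)
ribbonGrow-special T s Q e rewrite e = refl

-- after k insertions the upper path has its points in the columns −k … k
columns : ℕ → List ℤ
columns k = range (Z.- + k) (suc (k + k))

column-≥ : ∀ R x → Z.- + length R Z.≤ column R x
column-≥ R x = ZP.i≤j+i (Z.- + length R) (+ (below R x + below R x))

column-< : ∀ R x → column R x Z.< Z.- + length R +ᶻ + suc (length R + length R)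
column-< R x = subst (Z._< _) (ZP.+-comm (Z.- + k) (+ (b + b)))
                 (ZP.+-monoʳ-< (Z.- + k) (Z.+<+ (s≤s (NP.+-mono-≤ b≤k b≤k))))
  where
  k = length R
  b = below R x
  b≤k = count-≤-length (λ v → v <ℕ x) R

columns-spread : ∀ R x Up → map proj₁ Up ≡ columns (length R) →
                 map proj₁ (spreadPath (column R x) Up) ≡ columns (suc (length R))
columns-spread R x Up Up≡ =
  trans (xs-spreadPath (column R x) (suc (k + k)) (Z.- + k) Up Up≡ (column-≥ R x) (column-< R x))
        (cong₂ range (-k-1 (+ k)) (cong (λ t → suc (suc t)) (sym (NP.+-suc k k))))
  where
  k = length R
  -k-1 : ∀ K → Z.- K -ᶻ 1ℤ ≡ Z.- (1ℤ +ᶻ K)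
  -k-1 = solveℤ

-- T′ is T after inserting x behind the word y ∷ r
record Grown (T : Tiling) (x y : ℕ) (r : List ℕ) (T′ : Tiling) : Set where
  field
    columns′ : map proj₁ (upper T′) ≡ columns (suc (length (y ∷ r)))
    boxes′   : ∀ z → ¬ z ≡ x → ¬ z ≡ y →
               columnBoxes T′ (column (x ∷ y ∷ r) z)
                 ≡ columnBoxes T (column (y ∷ r) z) + 𝟙 ((x <ℕ z) ∧ (z <ℕ y))
    special′ : SpecialAt T′ (column (y ∷ r) x)
    weight′  : weight T′ ≡ weight T + (columnBoxes T (column (y ∷ r) x) + columnBoxes T (column (y ∷ r) x))
                                    + (ribbonLength x y r + ribbonLength x y r)

grow-above : ∀ x y r T → map proj₁ (upper T) ≡ columns (length (y ∷ r)) →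
             SpecialAt T (column (y ∷ r) y +ᶻ 1ℤ) → y < x →
             Grown T x y r (ribbonGrow T (column (y ∷ r) x))
grow-above x y r T columns≡ S y<x = subst (Grown T x y r) (sym grows) (record
  { columns′ = columns-spread R x (upper T) columns≡
  ; boxes′ = λ z z≢x _ → trans (columnBoxes-spread-column T x R z z≢x)
                               (sym (trans (cong (λ b → _ + 𝟙 b) (between-empty x y z x≮y)) (NP.+-identityʳ _)))
  ; special′ = special-s
  ; weight′ = trans (weight-spread T s)
                    (sym (trans (cong (λ l → weight T + (columnBoxes T s + columnBoxes T s) + (l + l)) noRibbon)
                                (NP.+-identityʳ _)))
  })
  where
  R = y ∷ r
  s = column R x
  x≮y : (x <ℕ y) ≡ false
  x≮y = <ℕ-false (NP.<-asym y<x)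
  noRibbon : ribbonLength x y r ≡ 0
  noRibbon = cong (λ b → if b then suc (between x y r + between x y r) else 0) x≮y
  P<s : column R y +ᶻ 1ℤ Z.< s
  P<s = column-head-< y r x y<x
  special-s : SpecialAt (spread T s) s
  special-s = spread-right-of-special T s _ S P<s
                (range-split s (suc (length R + length R)) _ (upper T) columns≡ (column-≥ R x) (column-< R x))
  grows : ribbonGrow T s ≡ spread T s
  grows = trans (ribbonGrow-special T s s (special-SpecialAt _ s special-s))
                (cong (λ b → if b then addRibbon s s (spread T s) else spread T s) (<ℤ-false {s} {s} ≮-self))

-- The ribbon laid when x < y spans the columns s+1 … s+d, d = 2·between x y r + 1.
ribbonEnd : ∀ x y r → x < y → x ∉ r →
  (column (y ∷ r) y +ᶻ 1ℤ) +ᶻ 1ℤ ≡ (column (y ∷ r) x +ᶻ 1ℤ) +ᶻ + suc (between x y r + between x y r)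
ribbonEnd x y r x<y x∉r rewrite column-between r x y x<y x∉r =
  regroup (column (y ∷ r) x) (+ (between x y r + between x y r))
  where regroup : ∀ S X → ((S +ᶻ X) +ᶻ 1ℤ) +ᶻ 1ℤ ≡ (S +ᶻ 1ℤ) +ᶻ (1ℤ +ᶻ X)
        regroup = solveℤ

columns-end : ∀ k → (Z.- + k +ᶻ + suc (k + k)) +ᶻ 1ℤ ≡ Z.- + suc k +ᶻ + suc (suc k + suc k)
columns-end k rewrite ZP.pos-+ k k | ZP.pos-+ (suc k) (suc k) = regroup (+ k)
  where regroup : ∀ K → (Z.- K +ᶻ (1ℤ +ᶻ (K +ᶻ K))) +ᶻ 1ℤ
                        ≡ Z.- (1ℤ +ᶻ K) +ᶻ (1ℤ +ᶻ ((1ℤ +ᶻ K) +ᶻ (1ℤ +ᶻ K)))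
        regroup = solveℤ

ribbon-columns : ∀ x y r T′ → x < y → x ∉ r → map proj₁ (upper T′) ≡ columns (suc (length (y ∷ r))) →
  let s = column (y ∷ r) x ; d = suc (between x y r + between x y r) in
  map proj₁ (ribbon s ((column (y ∷ r) y +ᶻ 1ℤ) +ᶻ 1ℤ) T′) ≡ range (s +ᶻ 1ℤ) d
ribbon-columns x y r T′ x<y x∉r columns≡ rewrite ribbonEnd x y r x<y x∉r =
  xs-ribbon s d (suc (suc k + suc k)) (Z.- + suc k) T′ columns≡ start end
  where
  R = y ∷ r
  k = length R
  s = column R x
  d = suc (between x y r + between x y r)
  start : Z.- + suc k Z.≤ s +ᶻ 1ℤ
  start = ZP.≤-trans (subst (Z._≤ Z.- + k) (sym (neg-suc (+ k))) (ZP.<⇒≤ (i-1<i (Z.- + k))))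
                     (ZP.≤-trans (column-≥ R x) (ZP.<⇒≤ (i<i+1 s)))
    where neg-suc : ∀ K → Z.- (1ℤ +ᶻ K) ≡ Z.- K -ᶻ 1ℤ
          neg-suc = solveℤ
  end : (s +ᶻ 1ℤ) +ᶻ + d Z.≤ Z.- + suc k +ᶻ + suc (suc k + suc k)
  end = subst₂ Z._≤_ (ribbonEnd x y r x<y x∉r) (columns-end k)
          (ZP.+-monoˡ-≤ 1ℤ (i<j⇒i+1≤j (column-< R y)))

-- The ribbon adds one box exactly in the columns of the letters between x and y.
ribbon-hits : ∀ x y r z → x < y → x ∉ r → ¬ z ≡ x → ¬ z ≡ y →
  count (_=ℤ column (x ∷ y ∷ r) z) (range (column (y ∷ r) x +ᶻ 1ℤ) (suc (between x y r + between x y r)))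
    ≡ 𝟙 ((x <ℕ z) ∧ (z <ℕ y))
ribbon-hits x y r z x<y x∉r z≢x z≢y with NP.<-cmp z x
... | tri< z<x _ _ =
  trans (count-range-below d (column R x +ᶻ 1ℤ) (column (x ∷ R) z)
          (ZP.<-≤-trans (subst (column (x ∷ R) z Z.<_) (column-∷-< x R z z<x) (i<i+1 _))
                        (ZP.≤-trans (column-mono R (NP.<⇒≤ z<x)) (ZP.<⇒≤ (i<i+1 _)))))
        (cong (λ b → 𝟙 (b ∧ (z <ℕ y))) (sym (<ℕ-false (NP.<-asym z<x))))
  where R = y ∷ r
        d = suc (between x y r + between x y r)
... | tri≈ _ z≡x _ = ⊥-elim (z≢x z≡x)
... | tri> _ _ x<z with NP.<-cmp z y
...   | tri< z<y _ _ =
  trans (cong (λ c → count (_=ℤ c) (range (column R x +ᶻ 1ℤ) d)) (column-∷-> x R z x<z))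
 (trans (count-range-inside d (column R x +ᶻ 1ℤ) (column R z +ᶻ 1ℤ)
          (ZP.+-monoˡ-≤ 1ℤ (column-mono R (NP.<⇒≤ x<z)))
          (subst (_ Z.<_) (ribbonEnd x y r x<y x∉r)
                 (+1-mono-< (ZP.≤-<-trans (column-mono R (NP.<⇒≤ z<y)) (i<i+1 _)))))
        (cong₂ (λ b c → 𝟙 (b ∧ c)) (sym (<ℕ-true x<z)) (sym (<ℕ-true z<y))))
  where R = y ∷ r
        d = suc (between x y r + between x y r)
...   | tri≈ _ z≡y _ = ⊥-elim (z≢y z≡y)
...   | tri> _ _ y<z =
  trans (cong (λ c → count (_=ℤ c) (range (column R x +ᶻ 1ℤ) d)) (column-∷-> x R z x<z))
 (trans (count-range-above d (column R x +ᶻ 1ℤ) (column R z +ᶻ 1ℤ)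
          (subst (Z._≤ column R z +ᶻ 1ℤ) (ribbonEnd x y r x<y x∉r)
                 (ZP.≤-trans (i<j⇒i+1≤j (column-head-< y r z y<z)) (ZP.<⇒≤ (i<i+1 _)))))
        (cong₂ (λ b c → 𝟙 (b ∧ c)) (sym (<ℕ-true x<z)) (sym (<ℕ-false (NP.<-asym y<z)))))
  where R = y ∷ r
        d = suc (between x y r + between x y r)

grow-below : ∀ x y r T → map proj₁ (upper T) ≡ columns (length (y ∷ r)) →
             SpecialAt T (column (y ∷ r) y +ᶻ 1ℤ) → x < y → x ∉ r →
             Grown T x y r (ribbonGrow T (column (y ∷ r) x))
grow-below x y r T columns≡ S x<y x∉r = subst (Grown T x y r) (sym grows) (record
  { columns′ = trans (xs-addRibbon s Q T′) spread-columns
  ; boxes′ = λ z z≢x z≢y →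
      trans (columnBoxes-addRibbon s Q T′ _)
            (cong₂ _+_ (columnBoxes-spread-column T x R z z≢x)
                       (trans (ribbon-boxes _) (ribbon-hits x y r z x<y x∉r z≢x z≢y)))
  ; special′ = addRibbon-left-of-special L
  ; weight′ = trans (weight-addRibbon s Q T′)
               (trans (cong₂ (λ w l → w + (l + l)) (weight-spread T s) ribbon-length)
                      (cong (λ l → weight T + (columnBoxes T s + columnBoxes T s) + (l + l))
                            (sym (cong (λ b → if b then d else 0) (<ℕ-true x<y)))))
  })
  where
  R = y ∷ r
  s = column R x
  P = column R y +ᶻ 1ℤ
  Q = P +ᶻ 1ℤ
  d = suc (between x y r + between x y r)
  T′ = spread T s
  s<P : s Z.< P
  s<P = ZP.≤-<-trans (column-mono R (NP.<⇒≤ x<y)) (i<i+1 _)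
  L : LeftOfSpecial T s P
  L = left-of-special T s P S s<P
        (range-split s (suc (length R + length R)) _ (upper T) columns≡ (column-≥ R x) (column-< R x))
  grows : ribbonGrow T s ≡ addRibbon s Q T′
  grows = trans (ribbonGrow-special T s Q (special-SpecialAt _ Q (spread-left-of-special L)))
                (cong (λ b → if b then addRibbon s Q T′ else T′) (<ℤ-true (<-weakenʳ s<P)))
  spread-columns : map proj₁ (upper T′) ≡ columns (suc (length R))
  spread-columns = columns-spread R x (upper T) columns≡
  ribbon-length : length (ribbon s Q T′) ≡ d
  ribbon-length = trans (sym (LP.length-map proj₁ (ribbon s Q T′)))
                        (trans (cong length (ribbon-columns x y r T′ x<y x∉r spread-columns)) (length-range (s +ᶻ 1ℤ) d))
  ribbon-boxes : ∀ c → boxesAt c (ribbon s Q T′) ≡ count (_=ℤ c) (range (s +ᶻ 1ℤ) d)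
  ribbon-boxes c = trans (sym (count-map (_=ℤ c) proj₁ (ribbon s Q T′)))
                         (cong (count (_=ℤ c)) (ribbon-columns x y r T′ x<y x∉r spread-columns))

-- The tiling after inserting the letters of y ∷ r, y last.
record Invariant (y : ℕ) (r : List ℕ) (T : Tiling) : Set where
  field
    columns≡  : map proj₁ (upper T) ≡ columns (length (y ∷ r))
    boxes     : ∀ z → z ∉ y ∷ r → columnBoxes T (column (y ∷ r) z) ≡ ascentsAround z (y ∷ r)
    isSpecial : SpecialAt T (column (y ∷ r) y +ᶻ 1ℤ)
    weight≡   : weight T ≡ halfArt (y ∷ r) + halfArt (y ∷ r)

grow : ∀ x y r T → Invariant y r T → x ∉ y ∷ r → Grown T x y r (ribbonGrow T (column (y ∷ r) x))
grow x y r T I x∉ with NP.<-cmp x y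
... | tri< x<y _ _ = grow-below x y r T (Invariant.columns≡ I) (Invariant.isSpecial I) x<y (λ x∈r → x∉ (there x∈r))
... | tri≈ _ x≡y _ = ⊥-elim (x∉ (here x≡y))
... | tri> _ _ y<x = grow-above x y r T (Invariant.columns≡ I) (Invariant.isSpecial I) y<x

step : ∀ x y r T → Invariant y r T → x ∉ y ∷ r → Invariant x (y ∷ r) (ribbonGrow T (column (y ∷ r) x))
step x y r T I x∉ = record
  { columns≡ = columns′
  ; boxes = λ z z∉ →
      trans (boxes′ z (λ z≡x → z∉ (here z≡x)) (λ z≡y → z∉ (there (here z≡y))))
            (trans (cong (_+ _) (boxes z (λ z∈ → z∉ (there z∈)))) (NP.+-comm (ascentsAround z R) _))
  ; isSpecial = subst (SpecialAt _) (sym (column-∷-self x (y ∷ r))) special′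
  ; weight≡ = trans weight′ (begin
      weight T + (columnBoxes T (column R x) + columnBoxes T (column R x)) + (l + l)
        ≡⟨ cong₂ (λ w c → w + (c + c) + (l + l)) weight≡ (boxes x x∉) ⟩
      halfArt R + halfArt R + (ascentsAround x R + ascentsAround x R) + (l + l)
        ≡⟨ regroup (halfArt R) (ascentsAround x R) l ⟩
      halfArt (x ∷ R) + halfArt (x ∷ R) ∎)
  }
  where
  open Invariant I
  open Grown (grow x y r T I x∉)
  open ≡-Reasoning
  R = y ∷ r
  l = ribbonLength x y r
  regroup : ∀ h a l → h + h + (a + a) + (l + l) ≡ (h + a + l) + (h + a + l)
  regroup = solveℕ

initial : ∀ x → Invariant x [] (ribbonGrow emptyTiling (+ 0 Z.- + 0))
initial x = record
  { columns≡ = refl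
  ; boxes = λ _ _ → refl
  ; isSpecial = subst (SpecialAt _) (sym column≡0)
      (specialAt [] ((+ 1 , + 0) ∷ []) Z.-[1+ 0 ] (+ 0) refl (Z.-<+ ∷ []) (Z.+<+ (s≤s z≤n) ∷ []) refl [])
  ; weight≡ = refl
  }
  where
  column≡0 : column (x ∷ []) x +ᶻ 1ℤ ≡ + 0
  column≡0 = cong (λ b → (+ (b + b) -ᶻ + 1) +ᶻ 1ℤ) (below-∷-self x [])

growth : ∀ w x r T → Invariant x r T → Unique w → (∀ z → z ∈ w → z ∉ x ∷ r) →
  weight (DTRseqFrom (length (x ∷ r)) T (zigzagSeq (x ∷ r) w))
    ≡ halfArt (reverse w ++ x ∷ r) + halfArt (reverse w ++ x ∷ r)
growth []      x r T I _ _ = Invariant.weight≡ I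
growth (z ∷ w) x r T I (z∉w ∷ w!) fresh =
  trans (growth w z (x ∷ r) _ (step z x r T I (fresh z (here refl))) w! fresh′)
        (cong (λ L → halfArt L + halfArt L) reverse≡)
  where
  fresh′ : ∀ v → v ∈ w → v ∉ z ∷ x ∷ r
  fresh′ v v∈w (here v≡z) = All.lookup z∉w v∈w (sym v≡z)
  fresh′ v v∈w (there v∈) = fresh v (there v∈w) v∈
  reverse≡ : reverse w ++ z ∷ x ∷ r ≡ reverse (z ∷ w) ++ x ∷ r
  reverse≡ = trans (sym (LP.++-assoc (reverse w) (z ∷ []) (x ∷ r)))
                   (cong (_++ x ∷ r) (sym (LP.unfold-reverse z w)))

half : ∀ F → (F + F) / 2 ≡ F
half F = trans (cong (_/ 2) (double F)) (m*n/n≡m F 2)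
  where double : ∀ F → F + F ≡ F N.* 2
        double = solveℕ

weight-DTR-zigzag : ∀ W → Unique W → weight (DTRseq (zigzagSeq [] W)) ≡ halfArt (reverse W) + halfArt (reverse W)
weight-DTR-zigzag []      _          = refl
weight-DTR-zigzag (x ∷ w) (x∉w ∷ w!) =
  trans (growth w x [] _ (initial x) w! (λ z z∈w z≡x → All.lookup x∉w z∈w (sym (single z≡x))))
        (cong (λ L → halfArt L + halfArt L) (sym (LP.unfold-reverse x w)))
  where single : ∀ {z} → z ∈ x ∷ [] → z ≡ x
        single (here z≡x) = z≡x

theorem10 : (n : ℕ) (σ : Permutation′ n) → art (DTR (Z n) σ) ≡ mad (word σ)
theorem10 n σ = begin
  art (DTR (Z n) σ)                               ≡⟨ cong (λ p → weight (DTRseq p) / 2) (treeSeq-Z n σ) ⟩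
  weight (DTRseq (zigzagSeq [] W)) / 2            ≡⟨ cong (_/ 2) (weight-DTR-zigzag W (word-unique n σ)) ⟩
  (halfArt (reverse W) + halfArt (reverse W)) / 2 ≡⟨ half (halfArt (reverse W)) ⟩
  halfArt (reverse W)                             ≡⟨ madʳ≡halfArt n W (word-gap n σ) (reverse W) reversed-bounded
                                                                   (λ a b → sym (count-reverse _ W)) ⟨
  madʳ (reverse W)                                ≡⟨ mad-reverse (reverse W) ⟨
  mad (reverse (reverse W))                       ≡⟨ cong mad (LP.reverse-involutive W) ⟩
  mad W                                           ∎
  where
  open ≡-Reasoning
  W = word σ
  reversed-bounded : All (_< n) (reverse W)
  reversed-bounded = All-resp-↭ (↭-sym (↭-reverse W)) (word-bounded n σ)
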